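{- Let $p$ be an odd prime, $L=\langle -1,2\rangle\le\mathbb{Z}_p^{\times}$, and $\ell=[\mathbb{Z}_p^{\times}:L]$. Let $g$ be a primitive root of $\mathbb{Z}_p$, $A(i,j)=|(1+g^iL)\cap g^jL|$ for integers $i,j$, and $s(\ell)=\sum_{1\le i\le\ell,\ \gcd(i,\ell)=1}A(i,2i)$. If $\ell\in\{3,4,5\}$, then $s(\ell)>0$.
   Context: $\mathbb{Z}_p=\mathbb{Z}/p\mathbb{Z}$, $\mathbb{Z}_p^{\times}=\mathbb{Z}_p\setminus\{0\}$; $\langle -1,2\rangle$ is the subgroup generated by $-1$ and $2$. A primitive root is a generator of $\mathbb{Z}_p^{\times}$. For $S\subseteq\mathbb{Z}_p$, $a+S=\{a+s:s\in S\}$, $aS=\{as:s\in S\}$. -}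

module Defs where

open import Data.Nat using (ℕ; suc; _+_; _*_; _∸_; _^_; _≡ᵇ_; _≤_; _<_; NonZero)
open import Data.Nat.DivMod using (_%_)
open import Data.Nat.GCD using (gcd)
open import Data.Bool using (Bool; _∧_; _∨_; not)
open import Data.List using (List; upTo; filterᵇ; map; length)
open import Data.Bool.ListAction using (any)
open import Data.Nat.ListAction using (sum)
open import Data.Product using (∃)
open import Relation.Binary.PropositionalEquality using (_≡_)

module _ (p : ℕ) .{{_ : NonZero p}} where

  -- congruence modulo p (Z_p is represented by the residues 0,…,p-1)
  _≡ₚ_ : ℕ → ℕ → Bool
  a ≡ₚ b = (a % p) ≡ᵇ (b % p)

  units : List ℕ
  units = filterᵇ (λ x → not (x ≡ₚ 0)) (upTo p)

  -- L = ⟨-1,2⟩ = { ±2^k } ; exponents k < p suffice since 2^(p-1) ≡ 1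
  inL : ℕ → Bool
  inL x = any (λ k → (x ≡ₚ (2 ^ k)) ∨ ((x + 2 ^ k) ≡ₚ 0)) (upTo p)

  Lset : List ℕ
  Lset = filterᵇ inL units

  inAffCoset : ℕ → ℕ → ℕ → Bool
  inAffCoset c h x = any (λ y → x ≡ₚ (c + h * y)) Lset

  A : ℕ → ℕ → ℕ → ℕ
  A g i j = length (filterᵇ (λ x → inAffCoset 1 (g ^ i) x ∧ inAffCoset 0 (g ^ j) x) (upTo p))

  s : ℕ → ℕ → ℕ
  s g ℓ = sum (map (λ i → A g i (2 * i)) (filterᵇ (λ i → gcd i ℓ ≡ᵇ 1) (map suc (upTo ℓ))))

IsPrimitiveRoot : (p : ℕ) .{{_ : NonZero p}} → ℕ → Set
IsPrimitiveRoot p g = ∀ x → 1 ≤ x → x < p → ∃ λ k → (g ^ k) % p ≡ x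

{-# OPTIONS --safe #-}
-- The classes C_a = g^a L (a modulo ℓ) partition the units, and A(i, j) is the cyclotomic number
-- (i, j) of order ℓ: the number of y ∈ C_i with y + 1 ∈ C_j. Since -1 ∈ L, (a, b) = (b, a);
-- inverting y gives (a, b) = (-a, b - a); and since y + 1 is a non-unit only for y = -1 ∈ C_0, the
-- row sums are Σ_b (a, b) = (p - 1)/ℓ - [a = 0]. For ℓ = 3, 4, 5 these relations give
-- (1, 2) = (0, 0) + 1, 2 (1, 2) = (0, 0) + (0, 2) + 1 and 3 ((1, 2) + (1, 3)) = (p - 1)/5 + (0, 0) + 1,
-- while s(ℓ) is at least (1, 2), (1, 2) and (1, 2) + (1, 3) respectively.
module Submission where

open import Defs
open import Data.Nat using (ℕ; zero; suc; z<s; s<s; z≤n; s≤s; _+_; _*_; _∸_; _^_; _≡ᵇ_; _<ᵇ_; _≤_; _<_; NonZero; >-nonZero; >-nonZero⁻¹)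
open import Data.Nat.Base using (nonTrivial⇒n>1)
open import Data.Nat.Properties
open import Data.Nat.DivMod
open import Data.Nat.Divisibility using (_∣_; divides; ∣⇒≤; m%n≡0⇒n∣m; n∣m⇒m%n≡0)
open import Data.Nat.Primality using (Prime; euclidsLemma; prime⇒nonTrivial)
open import Data.Nat.Tactic.RingSolver using (solve-∀)
open import Data.Bool using (Bool; true; false; T; not; _∧_; _∨_; if_then_else_)
open import Data.Bool.Properties using (T-∨; T-∧; T-≡; ∧-assoc; ∧-zeroʳ; ∧-identityʳ)
open import Data.Bool.ListAction using (any; or)
open import Data.List using ([]; _∷_; applyUpTo; upTo; filterᵇ; length)
open import Data.List.Properties using (map-cong)
open import Data.Fin using (Fin; toℕ; fromℕ<)
open import Data.Fin.Properties using (toℕ-fromℕ<; toℕ<n; toℕ-injective; pigeonhole; injective⇒≤)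
open import Data.Fin.Permutation using (Permutation; permutation; _⟨$⟩ʳ_)
import Algebra.Properties.CommutativeMonoid.Sum as CommutativeMonoidSum
open import Algebra.Properties.CommutativeSemigroup +-commutativeSemigroup using (interchange)
open import Data.Empty using (⊥-elim)
open import Data.Product using (∃; _×_; _,_; proj₁; proj₂)
open import Data.Sum using (_⊎_; inj₁; inj₂)
open import Function using (_∘_; id)
open import Function.Bundles using (Equivalence)
open import Relation.Nullary using (¬_; Dec; yes; no)
open import Relation.Nullary.Decidable using (dec-true; dec-false)
open import Relation.Binary.Bundles using (Setoid)
import Relation.Binary.Construct.On as On
import Relation.Binary.Reasoning.Setoid as SetoidReasoning
open import Relation.Binary.Definitions using (Tri; tri<; tri≈; tri>)
open import Relation.Binary.PropositionalEquality

T-injective : ∀ {a b : Bool} → (T a → T b) → (T b → T a) → a ≡ b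
T-injective {true}  {true}  _ _ = refl
T-injective {true}  {false} a⇒b _ = ⊥-elim (a⇒b _)
T-injective {false} {true}  _ b⇒a = ⊥-elim (b⇒a _)
T-injective {false} {false} _ _ = refl

indicator : Bool → ℕ
indicator true  = 1
indicator false = 0

indicator-split : ∀ b c → indicator b ≡ indicator (b ∧ c) + indicator (b ∧ not c)
indicator-split false c     = refl
indicator-split true  true  = refl
indicator-split true  false = refl

indicator-<ᵇ-suc : ∀ b c m → indicator (b ∧ (c <ᵇ suc m)) ≡ indicator (b ∧ (c <ᵇ m)) + indicator (b ∧ (c ≡ᵇ m))
indicator-<ᵇ-suc false c m = refl
indicator-<ᵇ-suc true  c m with <-cmp c m
... | tri< c<m c≢m _ rewrite dec-true (c <? suc m) (m<n⇒m<1+n c<m) | dec-true (c <? m) c<m | dec-false (c ≟ m) c≢m = refl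
... | tri≈ c≮m refl _ rewrite dec-true (c <? suc c) ≤-refl | dec-false (c <? c) c≮m | dec-true (c ≟ c) refl = refl
... | tri> c≮m c≢m m<c rewrite dec-false (c <? suc m) (λ c<1+m → <⇒≱ m<c (≤-pred c<1+m)) | dec-false (c <? m) c≮m
                              | dec-false (c ≟ m) c≢m = refl

count : (ℕ → Bool) → ℕ → ℕ
count P zero    = 0
count P (suc n) = indicator (P 0) + count (P ∘ suc) n

length-filterᵇ-applyUpTo : ∀ (P : ℕ → Bool) (f : ℕ → ℕ) n →
  length (filterᵇ P (applyUpTo f n)) ≡ count (P ∘ f) n
length-filterᵇ-applyUpTo P f zero = refl
length-filterᵇ-applyUpTo P f (suc n) with P (f 0)
... | true  = cong suc (length-filterᵇ-applyUpTo P (f ∘ suc) n)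
... | false = length-filterᵇ-applyUpTo P (f ∘ suc) n

count-cong : ∀ {P Q : ℕ → Bool} n → (∀ x → x < n → P x ≡ Q x) → count P n ≡ count Q n
count-cong zero    P≡Q = refl
count-cong (suc n) P≡Q =
  cong₂ _+_ (cong indicator (P≡Q 0 (s≤s z≤n))) (count-cong n (λ x x<n → P≡Q (suc x) (s≤s x<n)))

count-false : ∀ {P : ℕ → Bool} n → (∀ x → x < n → P x ≡ false) → count P n ≡ 0
count-false zero    P≡false = refl
count-false (suc n) P≡false rewrite P≡false 0 (s≤s z≤n) =
  count-false n (λ x x<n → P≡false (suc x) (s≤s x<n))

count-+ : ∀ (P : ℕ → Bool) m n → count P (m + n) ≡ count P m + count (λ x → P (m + x)) n
count-+ P zero    n = refl
count-+ P (suc m) n =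
  trans (cong (indicator (P 0) +_) (count-+ (P ∘ suc) m n)) (sym (+-assoc (indicator (P 0)) _ _))

count-suc : ∀ (P : ℕ → Bool) n → count P (suc n) ≡ count P n + indicator (P n)
count-suc P n = begin
  count P (suc n)                           ≡⟨ cong (count P) (+-comm 1 n) ⟩
  count P (n + 1)                           ≡⟨ count-+ P n 1 ⟩
  count P n + (indicator (P (n + 0)) + 0)   ≡⟨ cong (λ k → count P n + (indicator (P k) + 0)) (+-identityʳ n) ⟩
  count P n + (indicator (P n) + 0)         ≡⟨ cong (count P n +_) (+-identityʳ _) ⟩
  count P n + indicator (P n)               ∎
  where open ≡-Reasoning

count-≡ᵇ : ∀ {a} n → a < n → count (_≡ᵇ a) n ≡ 1
count-≡ᵇ {zero}  (suc n) _         = cong suc (count-false n (λ _ _ → refl))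
count-≡ᵇ {suc a} (suc n) (s≤s a<n) = count-≡ᵇ n a<n

count-%≡ᵇ : ∀ m .{{_ : NonZero m}} {a} → a < m → ∀ q → count (λ k → k % m ≡ᵇ a) (m * q) ≡ q
count-%≡ᵇ m a<m zero = cong (count _) (*-zeroʳ m)
count-%≡ᵇ m {a} a<m (suc q) = begin
  count P (m * suc q)                          ≡⟨ cong (count P) (*-suc m q) ⟩
  count P (m + m * q)                          ≡⟨ count-+ P m (m * q) ⟩
  count P m + count (λ x → P (m + x)) (m * q)  ≡⟨ cong₂ _+_ first-period later-periods ⟩
  1 + q                                        ∎
  where
  open ≡-Reasoning
  P : ℕ → Bool
  P k = k % m ≡ᵇ a
  first-period : count P m ≡ 1
  first-period = trans (count-cong m (λ x x<m → cong (_≡ᵇ a) (m<n⇒m%n≡m x<m))) (count-≡ᵇ m a<m)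
  later-periods : count (λ x → P (m + x)) (m * q) ≡ q
  later-periods = trans (count-cong (m * q) (λ x _ → cong (_≡ᵇ a) (trans (cong (_% m) (+-comm m x)) ([m+n]%n≡m%n x m))))
                        (count-%≡ᵇ m a<m q)

count-split : ∀ {R P Q : ℕ → Bool} n → (∀ x → x < n → indicator (R x) ≡ indicator (P x) + indicator (Q x)) →
  count R n ≡ count P n + count Q n
count-split zero    split = refl
count-split {R} {P} {Q} (suc n) split = begin
  indicator (R 0) + count (R ∘ suc) n
    ≡⟨ cong₂ _+_ (split 0 (s≤s z≤n)) (count-split n (λ x x<n → split (suc x) (s≤s x<n))) ⟩
  (indicator (P 0) + indicator (Q 0)) + (count (P ∘ suc) n + count (Q ∘ suc) n)
    ≡⟨ interchange (indicator (P 0)) (indicator (Q 0)) _ _ ⟩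
  (indicator (P 0) + count (P ∘ suc) n) + (indicator (Q 0) + count (Q ∘ suc) n) ∎
  where open ≡-Reasoning

count-permute : ∀ (P : ℕ → Bool) n (σ τ : ℕ → ℕ) →
  (∀ x → x < n → σ x < n) → (∀ x → x < n → τ x < n) →
  (∀ x → x < n → σ (τ x) ≡ x) → (∀ x → x < n → τ (σ x) ≡ x) →
  count P n ≡ count (P ∘ σ) n
count-permute P n σ τ σ< τ< στ τσ = begin
  count P n                                        ≡⟨ count-sum n P ⟩
  sum {n} (λ i → indicator (P (toℕ i)))            ≡⟨ ∑-permute _ π ⟩
  sum {n} (λ i → indicator (P (toℕ (π ⟨$⟩ʳ i))))   ≡⟨ sum-cong-≗ (λ i → cong (indicator ∘ P) (toℕ-fromℕ< (σ< (toℕ i) (toℕ<n i)))) ⟩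
  sum {n} (λ i → indicator (P (σ (toℕ i))))        ≡⟨ count-sum n (P ∘ σ) ⟨
  count (P ∘ σ) n                              ∎
  where
  open ≡-Reasoning
  open CommutativeMonoidSum +-0-commutativeMonoid using (sum; ∑-permute; sum-cong-≗)
  count-sum : ∀ n (Q : ℕ → Bool) → count Q n ≡ sum {n} (λ i → indicator (Q (toℕ i)))
  count-sum zero    Q = refl
  count-sum (suc n) Q = cong (indicator (Q 0) +_) (count-sum n (Q ∘ suc))
  σ′ τ′ : Fin n → Fin n
  σ′ i = fromℕ< (σ< (toℕ i) (toℕ<n i))
  τ′ i = fromℕ< (τ< (toℕ i) (toℕ<n i))
  π : Permutation n n
  π = permutation σ′ τ′
    (λ i → toℕ-injective (trans (toℕ-fromℕ< _) (trans (cong σ (toℕ-fromℕ< _)) (στ (toℕ i) (toℕ<n i)))))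
    (λ i → toℕ-injective (trans (toℕ-fromℕ< _) (trans (cong τ (toℕ-fromℕ< _)) (τσ (toℕ i) (toℕ<n i)))))

sumBelow : (ℕ → ℕ) → ℕ → ℕ
sumBelow f zero    = 0
sumBelow f (suc m) = sumBelow f m + f m

any-applyUpTo⁻ : ∀ (f : ℕ → Bool) (h : ℕ → ℕ) n → T (any f (applyUpTo h n)) → ∃ λ k → k < n × T (f (h k))
any-applyUpTo⁻ f h (suc n) t with f (h 0) in eq
... | true  = 0 , z<s , subst T (sym eq) _
... | false with any-applyUpTo⁻ f (h ∘ suc) n t
...   | k , k<n , fk = suc k , s<s k<n , fk

any-applyUpTo⁺ : ∀ (f : ℕ → Bool) (h : ℕ → ℕ) n {k} → k < n → T (f (h k)) → T (any f (applyUpTo h n))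
any-applyUpTo⁺ f h (suc n) {zero}  _         fk = Equivalence.from T-∨ (inj₁ fk)
any-applyUpTo⁺ f h (suc n) {suc k} (s<s k<n) fk = Equivalence.from T-∨ (inj₂ (any-applyUpTo⁺ f (h ∘ suc) n k<n fk))

any-filterᵇ : ∀ (f P : ℕ → Bool) xs → any f (filterᵇ P xs) ≡ any (λ x → P x ∧ f x) xs
any-filterᵇ f P []       = refl
any-filterᵇ f P (x ∷ xs) with P x
... | true  = cong (f x ∨_) (any-filterᵇ f P xs)
... | false = any-filterᵇ f P xs

filterᵇ-filterᵇ : ∀ (P Q : ℕ → Bool) xs → filterᵇ P (filterᵇ Q xs) ≡ filterᵇ (λ x → Q x ∧ P x) xs
filterᵇ-filterᵇ P Q []       = refl
filterᵇ-filterᵇ P Q (x ∷ xs) with Q x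
... | false = filterᵇ-filterᵇ P Q xs
... | true with P x
...   | true  = cong (x ∷_) (filterᵇ-filterᵇ P Q xs)
...   | false = filterᵇ-filterᵇ P Q xs

least-positive : ∀ (P : ℕ → Bool) n →
  (∀ k → 1 ≤ k → k ≤ n → P k ≡ false) ⊎
  (∃ λ e → 1 ≤ e × e ≤ n × T (P e) × (∀ k → 1 ≤ k → k < e → P k ≡ false))
least-positive P zero = inj₁ (λ k 1≤k k≤0 → ⊥-elim (<⇒≱ 1≤k k≤0))
least-positive P (suc n) with least-positive P n
... | inj₂ (e , 1≤e , e≤n , Pe , least) = inj₂ (e , 1≤e , m≤n⇒m≤1+n e≤n , Pe , least)
... | inj₁ none with P (suc n) in eq
...   | true  = inj₂ (suc n , s≤s z≤n , ≤-refl , subst T (sym eq) _ , λ k 1≤k k≤n → none k 1≤k (≤-pred k≤n))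
...   | false = inj₁ λ k 1≤k k≤1+n → case k 1≤k k≤1+n
  where
  case : ∀ k → 1 ≤ k → k ≤ suc n → P k ≡ false
  case k 1≤k k≤1+n with m≤n⇒m<n∨m≡n k≤1+n
  ... | inj₁ k<1+n = none k 1≤k (≤-pred k<1+n)
  ... | inj₂ refl  = eq

module Congruence (m : ℕ) .{{_ : NonZero m}} where

  infix 4 _≈_
  _≈_ : ℕ → ℕ → Set
  x ≈ y = x % m ≡ y % m

  ≈-setoid : Setoid _ _
  ≈-setoid = On.setoid (setoid ℕ) (_% m)

  module ≈-Reasoning = SetoidReasoning ≈-setoid

  ≡⇒≈ : ∀ {x y} → x ≡ y → x ≈ y
  ≡⇒≈ = cong (_% m)

  %-≈ : ∀ x → x % m ≈ x
  %-≈ x = m%n%n≡m%n x m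

  +-cong : ∀ {x y u v} → x ≈ y → u ≈ v → x + u ≈ y + v
  +-cong {x} {y} {u} {v} x≈y u≈v = begin
    (x + u) % m              ≡⟨ %-distribˡ-+ x u m ⟩
    (x % m + u % m) % m      ≡⟨ cong₂ (λ a b → (a + b) % m) x≈y u≈v ⟩
    (y % m + v % m) % m      ≡⟨ %-distribˡ-+ y v m ⟨
    (y + v) % m              ∎
    where open ≡-Reasoning

  *-cong : ∀ {x y u v} → x ≈ y → u ≈ v → x * u ≈ y * v
  *-cong {x} {y} {u} {v} x≈y u≈v = begin
    (x * u) % m              ≡⟨ %-distribˡ-* x u m ⟩
    (x % m * (u % m)) % m    ≡⟨ cong₂ (λ a b → (a * b) % m) x≈y u≈v ⟩
    (y % m * (v % m)) % m    ≡⟨ %-distribˡ-* y v m ⟨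
    (y * v) % m              ∎
    where open ≡-Reasoning

  ^-congˡ : ∀ {x y} k → x ≈ y → x ^ k ≈ y ^ k
  ^-congˡ zero    x≈y = refl
  ^-congˡ (suc k) x≈y = *-cong x≈y (^-congˡ k x≈y)

  *-congˡ : ∀ {x u v} → u ≈ v → x * u ≈ x * v
  *-congˡ {x} = *-cong {x} refl

  ^d≈1⇒^[d*q]≈1 : ∀ {u d} q → u ^ d ≈ 1 → u ^ (d * q) ≈ 1
  ^d≈1⇒^[d*q]≈1 {u} {d} zero    _     = ≡⇒≈ (cong (u ^_) (*-zeroʳ d))
  ^d≈1⇒^[d*q]≈1 {u} {d} (suc q) ud≈1 = begin
    u ^ (d * suc q)       ≡⟨ cong (u ^_) (*-suc d q) ⟩
    u ^ (d + d * q)       ≡⟨ ^-distribˡ-+-* u d (d * q) ⟩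
    u ^ d * u ^ (d * q)   ≈⟨ *-cong ud≈1 (^d≈1⇒^[d*q]≈1 {u} {d} q ud≈1) ⟩
    1                     ∎
    where open ≈-Reasoning

  ^d≈1⇒^k≈^[k%d] : ∀ {u d} .{{_ : NonZero d}} k → u ^ d ≈ 1 → u ^ k ≈ u ^ (k % d)
  ^d≈1⇒^k≈^[k%d] {u} {d} k ud≈1 = begin
    u ^ k                           ≡⟨ cong (u ^_) (m≡m%n+[m/n]*n k d) ⟩
    u ^ (k % d + k / d * d)         ≡⟨ cong (λ e → u ^ (k % d + e)) (*-comm (k / d) d) ⟩
    u ^ (k % d + d * (k / d))       ≡⟨ ^-distribˡ-+-* u (k % d) _ ⟩
    u ^ (k % d) * u ^ (d * (k / d)) ≈⟨ *-congˡ {u ^ (k % d)} (^d≈1⇒^[d*q]≈1 {u} {d} (k / d) ud≈1) ⟩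
    u ^ (k % d) * 1                 ≡⟨ *-identityʳ _ ⟩
    u ^ (k % d)                     ∎
    where open ≈-Reasoning

  ≈⇒≡ : ∀ {x y} → x < m → y < m → x ≈ y → x ≡ y
  ≈⇒≡ x<m y<m x≈y = trans (sym (m<n⇒m%n≡m x<m)) (trans x≈y (m<n⇒m%n≡m y<m))

  0%≡0 : 0 % m ≡ 0
  0%≡0 = m<n⇒m%n≡m (>-nonZero⁻¹ m)

  m≈0 : m ≈ 0
  m≈0 = trans (n%n≡0 m) (sym 0%≡0)

  *m≈0 : ∀ x → x * m ≈ 0
  *m≈0 x = trans (m*n%n≡0 x m) (sym 0%≡0)

  ≈⇒∣∸ : ∀ {x y} → x ≈ y → m ∣ x ∸ y
  ≈⇒∣∸ {x} {y} x≈y = divides (x / m ∸ y / m) (begin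
    x ∸ y                                        ≡⟨ cong₂ _∸_ (m≡m%n+[m/n]*n x m) (m≡m%n+[m/n]*n y m) ⟩
    (x % m + x / m * m) ∸ (y % m + y / m * m)    ≡⟨ cong (λ r → (r + x / m * m) ∸ (y % m + y / m * m)) x≈y ⟩
    (y % m + x / m * m) ∸ (y % m + y / m * m)    ≡⟨ [m+n]∸[m+o]≡n∸o (y % m) _ _ ⟩
    x / m * m ∸ y / m * m                        ≡⟨ *-distribʳ-∸ m (x / m) (y / m) ⟨
    (x / m ∸ y / m) * m                          ∎)
    where open ≡-Reasoning

  b+[m∸b%m]≈0 : ∀ b → b + (m ∸ b % m) ≈ 0
  b+[m∸b%m]≈0 b = begin
    b + (m ∸ b % m)        ≈⟨ +-cong (%-≈ b) refl ⟨
    b % m + (m ∸ b % m)    ≡⟨ m+[n∸m]≡n (m%n≤n b m) ⟩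
    m                      ≈⟨ m≈0 ⟩
    0                      ∎
    where open ≈-Reasoning

  +-cancelʳ-≈ : ∀ {u v} b → u + b ≈ v + b → u ≈ v
  +-cancelʳ-≈ {u} {v} b u+b≈v+b = begin
    u                   ≡⟨ +-identityʳ u ⟨
    u + 0               ≈⟨ +-cong {u} refl (b+[m∸b%m]≈0 b) ⟨
    u + (b + c)         ≡⟨ +-assoc u b c ⟨
    u + b + c           ≈⟨ +-cong u+b≈v+b refl ⟩
    v + b + c           ≡⟨ +-assoc v b c ⟩
    v + (b + c)         ≈⟨ +-cong {v} refl (b+[m∸b%m]≈0 b) ⟩
    v + 0               ≡⟨ +-identityʳ v ⟩
    v                   ∎
    where
    open ≈-Reasoning
    c = m ∸ b % m

  +-cancelˡ-≈ : ∀ b {u v} → b + u ≈ b + v → u ≈ v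
  +-cancelˡ-≈ b {u} {v} b+u≈b+v =
    +-cancelʳ-≈ b (trans (≡⇒≈ (+-comm u b)) (trans b+u≈b+v (≡⇒≈ (+-comm b v))))

module Units (p : ℕ) .{{_ : NonZero p}} (p-prime : Prime p) where

  open Congruence p public

  1<p : 1 < p
  1<p = nonTrivial⇒n>1 p {{prime⇒nonTrivial p-prime}}

  N : ℕ
  N = p ∸ 1

  p≡1+N : p ≡ suc N
  p≡1+N = sym (m+[n∸m]≡n {1} {p} (<⇒≤ 1<p))

  N<p : N < p
  N<p = subst (N <_) (sym p≡1+N) (n<1+n N)

  0<N : 0 < N
  0<N = ≤-pred (subst (1 <_) p≡1+N 1<p)

  instance
    N-nonZero : NonZero N
    N-nonZero = >-nonZero 0<N

  Unit : ℕ → Set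
  Unit x = ¬ (x % p ≡ 0)

  Unit? : ∀ x → Dec (Unit x)
  Unit? x with x % p ≟ 0
  ... | yes x≈0 = no (λ u → u x≈0)
  ... | no  x≉0 = yes x≉0

  Unit-resp-≈ : ∀ {x y} → x ≈ y → Unit x → Unit y
  Unit-resp-≈ x≈y ux y≈0 = ux (trans x≈y y≈0)

  ¬Unit⇒≈0 : ∀ {x} → ¬ Unit x → x ≈ 0
  ¬Unit⇒≈0 {x} ¬ux with x % p ≟ 0
  ... | yes x≈0 = trans x≈0 (sym 0%≡0)
  ... | no  x≉0 = ⊥-elim (¬ux x≉0)

  ¬Unit-0 : ¬ Unit 0
  ¬Unit-0 u = u 0%≡0

  <p⇒Unit : ∀ {x} → x < p → x ≢ 0 → Unit x
  <p⇒Unit x<p x≢0 x%p≡0 = x≢0 (trans (sym (m<n⇒m%n≡m x<p)) x%p≡0)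

  Unit-1 : Unit 1
  Unit-1 = <p⇒Unit 1<p (λ ())

  Unit-* : ∀ {x y} → Unit x → Unit y → Unit (x * y)
  Unit-* {x} {y} ux uy xy≈0 with euclidsLemma x y p-prime (m%n≡0⇒n∣m (x * y) p xy≈0)
  ... | inj₁ p∣x = ux (n∣m⇒m%n≡0 x p p∣x)
  ... | inj₂ p∣y = uy (n∣m⇒m%n≡0 y p p∣y)

  Unit-*⁻ʳ : ∀ {x y} → Unit (x * y) → Unit y
  Unit-*⁻ʳ {x} {y} uxy y≈0 = uxy (begin
    (x * y) % p      ≡⟨ *-congˡ {x} (trans y≈0 (sym 0%≡0)) ⟩
    (x * 0) % p      ≡⟨ cong (_% p) (*-zeroʳ x) ⟩
    0 % p            ≡⟨ 0%≡0 ⟩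
    0                ∎)
    where open ≡-Reasoning

  Unit-*⁻ˡ : ∀ {x y} → Unit (x * y) → Unit x
  Unit-*⁻ˡ {x} {y} uxy = Unit-*⁻ʳ {y} (subst Unit (*-comm x y) uxy)

  Unit-^ : ∀ {x} k → Unit x → Unit (x ^ k)
  Unit-^ zero    ux = Unit-1
  Unit-^ (suc k) ux = Unit-* ux (Unit-^ k ux)

  *-cancelˡ-≈-≤ : ∀ {a u v} → Unit a → v ≤ u → u < p → a * u ≈ a * v → u ≡ v
  *-cancelˡ-≈-≤ {a} {u} {v} ua v≤u u<p au≈av
    with euclidsLemma a (u ∸ v) p-prime (subst (p ∣_) (sym (*-distribˡ-∸ a u v)) (≈⇒∣∸ au≈av))
  ... | inj₁ p∣a   = ⊥-elim (ua (n∣m⇒m%n≡0 a p p∣a))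
  ... | inj₂ p∣u∸v = ≤-antisym (m∸n≡0⇒m≤n u∸v≡0) v≤u
    where u∸v≡0 = trans (sym (m<n⇒m%n≡m (≤-<-trans (m∸n≤m u v) u<p))) (n∣m⇒m%n≡0 _ p p∣u∸v)

  *-cancelˡ-≈-< : ∀ {a u v} → Unit a → u < p → v < p → a * u ≈ a * v → u ≡ v
  *-cancelˡ-≈-< {u = u} {v} ua u<p v<p au≈av with ≤-total u v
  ... | inj₁ u≤v = sym (*-cancelˡ-≈-≤ ua u≤v v<p (sym au≈av))
  ... | inj₂ v≤u = *-cancelˡ-≈-≤ ua v≤u u<p au≈av

  *-cancelˡ-≈ : ∀ {a x y} → Unit a → a * x ≈ a * y → x ≈ y
  *-cancelˡ-≈ {a} {x} {y} ua ax≈ay = *-cancelˡ-≈-< ua (m%n<n x p) (m%n<n y p)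
    (trans (*-congˡ {a} (%-≈ x)) (trans ax≈ay (*-congˡ {a} (sym (%-≈ y)))))

  unitᵇ : ℕ → Bool
  unitᵇ x = not (_≡ₚ_ p x 0)

  unitᵇ-resp-≈ : ∀ {x y} → x ≈ y → unitᵇ x ≡ unitᵇ y
  unitᵇ-resp-≈ x≈y = cong (λ r → not (r ≡ᵇ 0 % p)) x≈y

  Unit⇒unitᵇ : ∀ {x} → Unit x → unitᵇ x ≡ true
  Unit⇒unitᵇ {x} ux = cong not (dec-false (x % p ≟ 0 % p) (λ x≈0 → ux (trans x≈0 0%≡0)))

  ¬Unit⇒unitᵇ : ∀ {x} → ¬ Unit x → unitᵇ x ≡ false
  ¬Unit⇒unitᵇ {x} ¬ux = cong not (dec-true (x % p ≟ 0 % p) (¬Unit⇒≈0 ¬ux))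

  unitᵇ⇒Unit : ∀ {x} → T (unitᵇ x) → Unit x
  unitᵇ⇒Unit {x} t with Unit? x
  ... | yes ux  = ux
  ... | no ¬ux = ⊥-elim (subst T (¬Unit⇒unitᵇ ¬ux) t)

  x+p≈x : ∀ x → x + p ≈ x
  x+p≈x x = begin
    x + p    ≈⟨ +-cong {x} refl m≈0 ⟩
    x + 0    ≡⟨ +-identityʳ x ⟩
    x        ∎
    where open ≈-Reasoning

  x+1+N≈x : ∀ x → x + 1 + N ≈ x
  x+1+N≈x x = trans (≡⇒≈ (trans (+-assoc x 1 N) (cong (x +_) (sym p≡1+N)))) (x+p≈x x)

  x+N+1≈x : ∀ x → x + N + 1 ≈ x
  x+N+1≈x x = trans (≡⇒≈ (trans (+-assoc x N 1) (cong (x +_) (trans (+-comm N 1) (sym p≡1+N))))) (x+p≈x x)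

  -- N represents -1.
  +≈0⇒≈N* : ∀ {x y} → x + y ≈ 0 → x ≈ N * y
  +≈0⇒≈N* {x} {y} x+y≈0 = begin
    x                    ≡⟨ +-identityʳ x ⟨
    x + 0                ≈⟨ +-cong {x} refl (*-cong {x + y} {0} {N} x+y≈0 refl) ⟨
    x + (x + y) * N      ≡⟨ distribute x y N ⟩
    x * suc N + y * N    ≡⟨ cong (λ q → x * q + y * N) p≡1+N ⟨
    x * p + y * N        ≈⟨ +-cong (*m≈0 x) refl ⟩
    y * N                ≡⟨ *-comm y N ⟩
    N * y                ∎
    where
    open ≈-Reasoning
    distribute : ∀ x y N → x + (x + y) * N ≡ x * suc N + y * N
    distribute = solve-∀

  ≈N*⇒+≈0 : ∀ {x y} → x ≈ N * y → x + y ≈ 0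
  ≈N*⇒+≈0 {x} {y} x≈N*y = begin
    x + y          ≈⟨ +-cong x≈N*y refl ⟩
    N * y + y      ≡⟨ +-comm (N * y) y ⟩
    suc N * y      ≡⟨ cong (_* y) p≡1+N ⟨
    p * y          ≡⟨ *-comm p y ⟩
    y * p          ≈⟨ *m≈0 y ⟩
    0              ∎
    where open ≈-Reasoning

  N*N≈1 : N * N ≈ 1
  N*N≈1 = sym (+≈0⇒≈N* (trans (≡⇒≈ (sym p≡1+N)) m≈0))

module DiscreteLog (p : ℕ) .{{_ : NonZero p}} (p-prime : Prime p) (2<p : 2 < p)
                   (g : ℕ) (g-primitive : IsPrimitiveRoot p g) where

  open Units p p-prime public

  Unit-g : Unit g
  Unit-g g≈0 with g-primitive 2 (s≤s z≤n) 2<p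
  ... | zero  , 1≈2 with () ← trans (sym (m<n⇒m%n≡m 1<p)) 1≈2
  ... | suc k , g^[1+k]≈2
    with () ← trans (sym (trans (*-cong {g} {0} {g ^ k} (trans g≈0 (sym 0%≡0)) refl) 0%≡0)) g^[1+k]≈2

  Unit-g^ : ∀ k → Unit (g ^ k)
  Unit-g^ k = Unit-^ k Unit-g

  g^-period : ∀ {i j} → i < j → g ^ i ≈ g ^ j → g ^ (j ∸ i) ≈ 1
  g^-period {i} {j} i<j g^i≈g^j = *-cancelˡ-≈ (Unit-g^ i) (begin
    g ^ i * g ^ (j ∸ i)  ≡⟨ ^-distribˡ-+-* g i (j ∸ i) ⟨
    g ^ (i + (j ∸ i))    ≡⟨ cong (g ^_) (m+[n∸m]≡n (<⇒≤ i<j)) ⟩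
    g ^ j                ≈⟨ g^i≈g^j ⟨
    g ^ i                ≡⟨ *-identityʳ (g ^ i) ⟨
    g ^ i * 1            ∎)
    where open ≈-Reasoning

  -- The powers g^k with k < d already meet all N units.
  g^d≈1⇒N≤d : ∀ d .{{_ : NonZero d}} → g ^ d ≈ 1 → N ≤ d
  g^d≈1⇒N≤d d g^d≈1 = injective⇒≤ {f = exponent} exponent-injective
    where
    unit< : ∀ (x : Fin N) → suc (toℕ x) < p
    unit< x = subst (suc (toℕ x) <_) (sym p≡1+N) (s<s (toℕ<n x))
    log′ : Fin N → ℕ
    log′ x = proj₁ (g-primitive (suc (toℕ x)) (s≤s z≤n) (unit< x))
    g^log′ : ∀ x → g ^ log′ x % p ≡ suc (toℕ x)
    g^log′ x = proj₂ (g-primitive (suc (toℕ x)) (s≤s z≤n) (unit< x))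
    exponent : Fin N → Fin d
    exponent x = fromℕ< (m%n<n (log′ x) d)
    exponent-injective : ∀ {x y} → exponent x ≡ exponent y → x ≡ y
    exponent-injective {x} {y} eq = toℕ-injective (suc-injective (begin
      suc (toℕ x)           ≡⟨ g^log′ x ⟨
      g ^ log′ x % p        ≡⟨ ^d≈1⇒^k≈^[k%d] (log′ x) g^d≈1 ⟩
      g ^ (log′ x % d) % p  ≡⟨ cong (λ k → g ^ k % p) log′≡ ⟩
      g ^ (log′ y % d) % p  ≡⟨ ^d≈1⇒^k≈^[k%d] (log′ y) g^d≈1 ⟨
      g ^ log′ y % p        ≡⟨ g^log′ y ⟩
      suc (toℕ y)           ∎))
      where
      open ≡-Reasoning
      log′≡ : log′ x % d ≡ log′ y % d
      log′≡ = trans (sym (toℕ-fromℕ< _)) (trans (cong toℕ eq) (toℕ-fromℕ< _))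

  -- Pigeonhole: the p powers g^0, …, g^N take only N values.
  g^N≈1 : g ^ N ≈ 1
  g^N≈1 with pigeonhole N<p
    (λ i → fromℕ< (∸-monoˡ-< (m%n<n (g ^ toℕ i) p) (n≢0⇒n>0 (Unit-g^ (toℕ i)))))
  ... | i , j , i<j , same-index = subst (λ d → g ^ d ≈ 1) j∸i≡N g^[j∸i]≈1
    where
    g^[j∸i]≈1 : g ^ (toℕ j ∸ toℕ i) ≈ 1
    g^[j∸i]≈1 = g^-period i<j (∸-cancelʳ-≡ (n≢0⇒n>0 (Unit-g^ (toℕ i))) (n≢0⇒n>0 (Unit-g^ (toℕ j)))
      (trans (sym (toℕ-fromℕ< _)) (trans (cong toℕ same-index) (toℕ-fromℕ< _))))
    j∸i≡N : toℕ j ∸ toℕ i ≡ N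
    j∸i≡N = ≤-antisym (≤-trans (m∸n≤m (toℕ j) (toℕ i)) (≤-pred (subst (toℕ j <_) p≡1+N (toℕ<n j))))
                      (g^d≈1⇒N≤d _ {{>-nonZero (m<n⇒0<n∸m i<j)}} g^[j∸i]≈1)

  g^-%N : ∀ k → g ^ k ≈ g ^ (k % N)
  g^-%N k = ^d≈1⇒^k≈^[k%d] {g} {N} k g^N≈1

  g^-injective : ∀ {i j} → i < N → j < N → g ^ i ≈ g ^ j → i ≡ j
  g^-injective {i} {j} i<N j<N g^i≈g^j with <-cmp i j
  ... | tri≈ _ i≡j _ = i≡j
  ... | tri< i<j _ _ = ⊥-elim (<⇒≱ (≤-<-trans (m∸n≤m j i) j<N)
                                  (g^d≈1⇒N≤d _ {{>-nonZero (m<n⇒0<n∸m i<j)}} (g^-period i<j g^i≈g^j)))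
  ... | tri> _ _ j<i = ⊥-elim (<⇒≱ (≤-<-trans (m∸n≤m i j) i<N)
                                  (g^d≈1⇒N≤d _ {{>-nonZero (m<n⇒0<n∸m j<i)}} (g^-period j<i (sym g^i≈g^j))))

  -- On non-units log takes the junk value 0.
  log : ℕ → ℕ
  log x with x % p ≟ 0
  ... | yes _   = 0
  ... | no x≉0 = proj₁ (g-primitive (x % p) (n≢0⇒n>0 x≉0) (m%n<n x p)) % N

  log<N : ∀ x → log x < N
  log<N x with x % p ≟ 0
  ... | yes _ = 0<N
  ... | no _  = m%n<n _ N

  g^log : ∀ {x} → Unit x → g ^ log x ≈ x
  g^log {x} ux with x % p ≟ 0
  ... | yes x≈0 = ⊥-elim (ux x≈0)
  ... | no x≉0 = trans (sym (g^-%N _)) (proj₂ (g-primitive (x % p) (n≢0⇒n>0 x≉0) (m%n<n x p)))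

  log-¬Unit : ∀ {x} → ¬ Unit x → log x ≡ 0
  log-¬Unit {x} ¬ux with x % p ≟ 0
  ... | yes _   = refl
  ... | no x≉0 = ⊥-elim (¬ux x≉0)

  log-unique : ∀ {x k} → Unit x → k < N → g ^ k ≈ x → log x ≡ k
  log-unique ux k<N g^k≈x = g^-injective (log<N _) k<N (trans (g^log ux) (sym g^k≈x))

  log-resp-≈ : ∀ {x y} → x ≈ y → log x ≡ log y
  log-resp-≈ {x} x≈y with Unit? x
  ... | yes ux = sym (log-unique (Unit-resp-≈ x≈y ux) (log<N x) (trans (g^log ux) x≈y))
  ... | no ¬ux = trans (log-¬Unit ¬ux) (sym (log-¬Unit (λ uy → ¬ux (Unit-resp-≈ (sym x≈y) uy))))

  log-g^ : ∀ k → log (g ^ k) ≡ k % N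
  log-g^ k = log-unique (Unit-g^ k) (m%n<n k N) (sym (g^-%N k))

  log-* : ∀ {x y} → Unit x → Unit y → log (x * y) ≡ (log x + log y) % N
  log-* {x} {y} ux uy = log-unique (Unit-* ux uy) (m%n<n _ N) (begin
    g ^ ((log x + log y) % N)   ≈⟨ g^-%N (log x + log y) ⟨
    g ^ (log x + log y)         ≡⟨ ^-distribˡ-+-* g (log x) (log y) ⟩
    g ^ log x * g ^ log y       ≈⟨ *-cong (g^log ux) (g^log uy) ⟩
    x * y                       ∎)
    where open ≈-Reasoning

  fermat : ∀ {u} → Unit u → u ^ N ≈ 1
  fermat {u} uu = begin
    u ^ N                ≈⟨ ^-congˡ N (g^log uu) ⟨
    (g ^ log u) ^ N      ≡⟨ ^-*-assoc g (log u) N ⟩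
    g ^ (log u * N)      ≡⟨ cong (g ^_) (*-comm (log u) N) ⟩
    g ^ (N * log u)      ≈⟨ ^d≈1⇒^[d*q]≈1 {g} {N} (log u) g^N≈1 ⟩
    1                    ∎
    where open ≈-Reasoning

  -- k ↦ g^k is a bijection from [0, N) onto the units; extended by N ↦ 0 it permutes [0, p).
  count-via-log : ∀ (P : ℕ → Bool) → P 0 ≡ false → count P p ≡ count (λ k → P (g ^ k % p)) N
  count-via-log P P0≡false = begin
    count P p                                            ≡⟨ count-permute P p exp log′ exp< log′< exp-log′ log′-exp ⟩
    count (P ∘ exp) p                                    ≡⟨ cong (count (P ∘ exp)) p≡1+N ⟩
    count (P ∘ exp) (suc N)                              ≡⟨ count-suc (P ∘ exp) N ⟩
    count (P ∘ exp) N + indicator (P (exp N))            ≡⟨ cong₂ _+_ (count-cong N (λ k k<N → cong P (exp-< k<N)))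
                                                                      (cong (indicator ∘ P) exp-N) ⟩
    count (λ k → P (g ^ k % p)) N + indicator (P 0)      ≡⟨ cong (λ b → count (λ k → P (g ^ k % p)) N + indicator b) P0≡false ⟩
    count (λ k → P (g ^ k % p)) N + 0                    ≡⟨ +-identityʳ _ ⟩
    count (λ k → P (g ^ k % p)) N                        ∎
    where
    open ≡-Reasoning
    exp : ℕ → ℕ
    exp k = if k <ᵇ N then g ^ k % p else 0
    log′ : ℕ → ℕ
    log′ x = if x ≡ᵇ 0 then N else log x
    exp-< : ∀ {k} → k < N → exp k ≡ g ^ k % p
    exp-< {k} k<N rewrite dec-true (k <? N) k<N = refl
    exp-N : exp N ≡ 0
    exp-N rewrite dec-false (N <? N) (<-irrefl refl) = refl
    exp< : ∀ k → k < p → exp k < p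
    exp< k _ with k <ᵇ N
    ... | true  = m%n<n _ p
    ... | false = <-trans z<s 1<p
    log′< : ∀ x → x < p → log′ x < p
    log′< x _ with x ≡ᵇ 0
    ... | true  = N<p
    ... | false = <-trans (log<N x) N<p
    exp-log′ : ∀ x → x < p → exp (log′ x) ≡ x
    exp-log′ zero    _     = exp-N
    exp-log′ (suc x) 1+x<p = begin
      exp (log (suc x))        ≡⟨ exp-< (log<N (suc x)) ⟩
      g ^ log (suc x) % p      ≡⟨ g^log (<p⇒Unit 1+x<p (λ ())) ⟩
      suc x % p                ≡⟨ m<n⇒m%n≡m 1+x<p ⟩
      suc x                    ∎
    log′-exp : ∀ k → k < p → log′ (exp k) ≡ k
    log′-exp k k<p with <-cmp k N
    ... | tri≈ _ refl _ = cong log′ exp-N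
    ... | tri> _ _ N<k  = ⊥-elim (<⇒≱ k<p (subst (_≤ k) (sym p≡1+N) N<k))
    ... | tri< k<N _ _  = begin
      log′ (exp k)        ≡⟨ cong log′ (exp-< k<N) ⟩
      log′ (g ^ k % p)    ≡⟨ cong (if_then N else log (g ^ k % p)) (dec-false (g ^ k % p ≟ 0) (Unit-g^ k)) ⟩
      log (g ^ k % p)     ≡⟨ log-resp-≈ (%-≈ (g ^ k)) ⟩
      log (g ^ k)         ≡⟨ log-g^ k ⟩
      k % N               ≡⟨ m<n⇒m%n≡m k<N ⟩
      k                   ∎

module Subgroup (p : ℕ) .{{_ : NonZero p}} (p-prime : Prime p) (2<p : 2 < p)
                (g : ℕ) (g-primitive : IsPrimitiveRoot p g) where

  open DiscreteLog p p-prime 2<p g g-primitive public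

  Unit-2 : Unit 2
  Unit-2 = <p⇒Unit 2<p (λ ())

  InL : ℕ → Set
  InL x = ∃ λ k → x ≈ 2 ^ k ⊎ x ≈ N * 2 ^ k

  InL-resp-≈ : ∀ {x y} → x ≈ y → InL x → InL y
  InL-resp-≈ x≈y (k , inj₁ x≈2^k)   = k , inj₁ (trans (sym x≈y) x≈2^k)
  InL-resp-≈ x≈y (k , inj₂ x≈-2^k) = k , inj₂ (trans (sym x≈y) x≈-2^k)

  InL-1 : InL 1
  InL-1 = 0 , inj₁ refl

  InL-N : InL N
  InL-N = 0 , inj₂ (≡⇒≈ (sym (*-identityʳ N)))

  InL-* : ∀ {x y} → InL x → InL y → InL (x * y)
  InL-* {x} {y} (a , inj₁ x≈) (b , inj₁ y≈) = a + b , inj₁ (begin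
    x * y            ≈⟨ *-cong x≈ y≈ ⟩
    2 ^ a * 2 ^ b    ≡⟨ ^-distribˡ-+-* 2 a b ⟨
    2 ^ (a + b)      ∎)
    where open ≈-Reasoning
  InL-* {x} {y} (a , inj₁ x≈) (b , inj₂ y≈) = a + b , inj₂ (begin
    x * y                  ≈⟨ *-cong x≈ y≈ ⟩
    2 ^ a * (N * 2 ^ b)    ≡⟨ x[Ny]≡N[xy] (2 ^ a) (2 ^ b) N ⟩
    N * (2 ^ a * 2 ^ b)    ≡⟨ cong (N *_) (^-distribˡ-+-* 2 a b) ⟨
    N * 2 ^ (a + b)        ∎)
    where
    open ≈-Reasoning
    x[Ny]≡N[xy] : ∀ x y N → x * (N * y) ≡ N * (x * y)
    x[Ny]≡N[xy] = solve-∀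
  InL-* {x} {y} (a , inj₂ x≈) (b , inj₁ y≈) = a + b , inj₂ (begin
    x * y                  ≈⟨ *-cong x≈ y≈ ⟩
    N * 2 ^ a * 2 ^ b      ≡⟨ *-assoc N (2 ^ a) (2 ^ b) ⟩
    N * (2 ^ a * 2 ^ b)    ≡⟨ cong (N *_) (^-distribˡ-+-* 2 a b) ⟨
    N * 2 ^ (a + b)        ∎)
    where open ≈-Reasoning
  InL-* {x} {y} (a , inj₂ x≈) (b , inj₂ y≈) = a + b , inj₁ (begin
    x * y                         ≈⟨ *-cong x≈ y≈ ⟩
    N * 2 ^ a * (N * 2 ^ b)       ≡⟨ [Nx][Ny]≡[NN][xy] (2 ^ a) (2 ^ b) N ⟩
    N * N * (2 ^ a * 2 ^ b)       ≈⟨ *-cong N*N≈1 refl ⟩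
    1 * (2 ^ a * 2 ^ b)           ≡⟨ *-identityˡ _ ⟩
    2 ^ a * 2 ^ b                 ≡⟨ ^-distribˡ-+-* 2 a b ⟨
    2 ^ (a + b)                   ∎)
    where
    open ≈-Reasoning
    [Nx][Ny]≡[NN][xy] : ∀ x y N → N * x * (N * y) ≡ N * N * (x * y)
    [Nx][Ny]≡[NN][xy] = solve-∀

  inL⇒InL : ∀ {x} → T (inL p x) → InL x
  inL⇒InL {x} t with any-applyUpTo⁻ _ id p t
  ... | k , _ , member with Equivalence.to T-∨ member
  ...   | inj₁ x≈2^k   = k , inj₁ (≡ᵇ⇒≡ _ _ x≈2^k)
  ...   | inj₂ x+2^k≈0 = k , inj₂ (+≈0⇒≈N* (≡ᵇ⇒≡ _ _ x+2^k≈0))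

  -- Exponents of 2 can be reduced below N < p by Fermat.
  InL⇒inL : ∀ {x} → InL x → T (inL p x)
  InL⇒inL {x} (k , x≈±2^k) = any-applyUpTo⁺ _ id p (<-trans (m%n<n k N) N<p) (Equivalence.from T-∨ (member x≈±2^k))
    where
    2^k≈2^[k%N] : 2 ^ k ≈ 2 ^ (k % N)
    2^k≈2^[k%N] = ^d≈1⇒^k≈^[k%d] {2} {N} k (fermat Unit-2)
    member : x ≈ 2 ^ k ⊎ x ≈ N * 2 ^ k → T (_≡ₚ_ p x (2 ^ (k % N))) ⊎ T (_≡ₚ_ p (x + 2 ^ (k % N)) 0)
    member (inj₁ x≈2^k)   = inj₁ (≡⇒≡ᵇ _ _ (trans x≈2^k 2^k≈2^[k%N]))
    member (inj₂ x≈-2^k) = inj₂ (≡⇒≡ᵇ _ _ (≈N*⇒+≈0 (trans x≈-2^k (*-congˡ {N} 2^k≈2^[k%N]))))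

  InL-g^-+ : ∀ a b → InL (g ^ a) → InL (g ^ b) → InL (g ^ (a + b))
  InL-g^-+ a b La Lb = InL-resp-≈ (≡⇒≈ (sym (^-distribˡ-+-* g a b))) (InL-* La Lb)

  InL-g^-* : ∀ a → InL (g ^ a) → ∀ q → InL (g ^ (a * q))
  InL-g^-* a La zero    = subst (InL ∘ (g ^_)) (sym (*-zeroʳ a)) InL-1
  InL-g^-* a La (suc q) = subst (InL ∘ (g ^_)) (sym (*-suc a q)) (InL-g^-+ a (a * q) La (InL-g^-* a La q))

  InL-g^N : InL (g ^ N)
  InL-g^N = InL-resp-≈ (sym g^N≈1) InL-1

  InL-g^-%N : ∀ k t → InL (g ^ (k + t * N)) → InL (g ^ k)
  InL-g^-%N k t = InL-resp-≈ (begin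
    g ^ (k + t * N)          ≈⟨ g^-%N (k + t * N) ⟩
    g ^ ((k + t * N) % N)    ≡⟨ cong (g ^_) ([m+kn]%n≡m%n k t N) ⟩
    g ^ (k % N)              ≈⟨ g^-%N k ⟨
    g ^ k                    ∎)
    where open ≈-Reasoning

  private
    least-exponent : ∃ λ e → 1 ≤ e × e ≤ N × T (inL p (g ^ e)) × (∀ k → 1 ≤ k → k < e → inL p (g ^ k) ≡ false)
    least-exponent with least-positive (λ k → inL p (g ^ k)) N
    ... | inj₂ found = found
    ... | inj₁ none  = ⊥-elim (subst T (none N 0<N ≤-refl) (InL⇒inL InL-g^N))

  -- L = ⟨g^index⟩, so index is the index of L in ℤ_p^×.
  index : ℕ
  index = proj₁ least-exponent

  0<index : 0 < index
  0<index = proj₁ (proj₂ least-exponent)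

  InL-g^index : InL (g ^ index)
  InL-g^index = inL⇒InL (proj₁ (proj₂ (proj₂ (proj₂ least-exponent))))

  index-minimal : ∀ k → 1 ≤ k → k < index → inL p (g ^ k) ≡ false
  index-minimal = proj₂ (proj₂ (proj₂ (proj₂ least-exponent)))

  instance
    index-nonZero : NonZero index
    index-nonZero = >-nonZero 0<index

  index∣⇒InL : ∀ {k} → index ∣ k → InL (g ^ k)
  index∣⇒InL (divides q refl) = subst (InL ∘ (g ^_)) (*-comm index q) (InL-g^-* index InL-g^index q)

  -- With k = r + m and index ∣ m, the exponent r + m·N of g^k · (g^m)^(N-1) reduces to r modulo N.
  InL⇒index∣ : ∀ {k} → InL (g ^ k) → index ∣ k
  InL⇒index∣ {k} Lk with k % index ≟ 0
  ... | yes r≡0 = m%n≡0⇒n∣m k index r≡0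
  ... | no  r≢0 = ⊥-elim (subst T (index-minimal r (n≢0⇒n>0 r≢0) (m%n<n k index)) (InL⇒inL Lr))
    where
    r = k % index
    m = k / index * index
    N-1 = N ∸ 1
    rearrange : ∀ r m N-1 → r + m * suc N-1 ≡ (r + m) + m * N-1
    rearrange = solve-∀
    r+mN≡k+m[N-1] : r + m * N ≡ k + m * N-1
    r+mN≡k+m[N-1] = begin
      r + m * N            ≡⟨ cong (λ n → r + m * n) (m+[n∸m]≡n {1} {N} 0<N) ⟨
      r + m * suc N-1      ≡⟨ rearrange r m N-1 ⟩
      (r + m) + m * N-1    ≡⟨ cong (_+ m * N-1) (m≡m%n+[m/n]*n k index) ⟨
      k + m * N-1          ∎
      where open ≡-Reasoning
    Lr : InL (g ^ r)
    Lr = InL-g^-%N r m (subst (InL ∘ (g ^_)) (sym r+mN≡k+m[N-1])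
           (InL-g^-+ k (m * N-1) Lk (InL-g^-* m (index∣⇒InL (divides (k / index) refl)) N-1)))

  index∣N : index ∣ N
  index∣N = InL⇒index∣ InL-g^N

  |L|≡N/index : length (Lset p) ≡ N / index
  |L|≡N/index = begin
    length (Lset p)                                ≡⟨ cong length (filterᵇ-filterᵇ (inL p) unitᵇ (upTo p)) ⟩
    length (filterᵇ unit∈L (upTo p))              ≡⟨ length-filterᵇ-applyUpTo unit∈L id p ⟩
    count unit∈L p                                 ≡⟨ count-via-log unit∈L (cong (_∧ inL p 0) (¬Unit⇒unitᵇ ¬Unit-0)) ⟩
    count (λ k → unit∈L (g ^ k % p)) N             ≡⟨ count-cong N (λ k _ → unit∈L-g^ k) ⟩
    count (λ k → k % index ≡ᵇ 0) N                 ≡⟨ cong (count _) (m*[n/m]≡n index∣N) ⟨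
    count (λ k → k % index ≡ᵇ 0) (index * (N / index)) ≡⟨ count-%≡ᵇ index 0<index (N / index) ⟩
    N / index                                      ∎
    where
    open ≡-Reasoning
    unit∈L : ℕ → Bool
    unit∈L x = unitᵇ x ∧ inL p x
    unit∈L-g^ : ∀ k → unit∈L (g ^ k % p) ≡ (k % index ≡ᵇ 0)
    unit∈L-g^ k rewrite Unit⇒unitᵇ (Unit-resp-≈ (sym (%-≈ (g ^ k))) (Unit-g^ k)) = T-injective
      (λ t → ≡⇒≡ᵇ _ _ (n∣m⇒m%n≡0 k index (InL⇒index∣ (InL-resp-≈ (%-≈ (g ^ k)) (inL⇒InL t)))))
      (λ t → InL⇒inL (InL-resp-≈ (sym (%-≈ (g ^ k))) (index∣⇒InL (m%n≡0⇒n∣m k index (≡ᵇ⇒≡ _ _ t)))))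

  any-Lset : ∀ f → any f (Lset p) ≡ any (λ z → (unitᵇ z ∧ inL p z) ∧ f z) (upTo p)
  any-Lset f = trans (cong (any f) (filterᵇ-filterᵇ (inL p) unitᵇ (upTo p))) (any-filterᵇ f _ (upTo p))

  any-Lset⁻ : ∀ f → T (any f (Lset p)) → ∃ λ z → (Unit z × InL z) × T (f z)
  any-Lset⁻ f t = witness (any-applyUpTo⁻ member id p (subst T (any-Lset f) t))
    where
    member : ℕ → Bool
    member z = (unitᵇ z ∧ inL p z) ∧ f z
    witness : (∃ λ z → z < p × T (member z)) → ∃ λ z → (Unit z × InL z) × T (f z)
    witness (z , _ , z-member) = z , (unitᵇ⇒Unit {z} (proj₁ z∈L) , inL⇒InL (proj₂ z∈L)) , proj₂ parts
      where
      parts = Equivalence.to (T-∧ {unitᵇ z ∧ inL p z} {f z}) z-member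
      z∈L = Equivalence.to (T-∧ {unitᵇ z} {inL p z}) (proj₁ parts)

  any-Lset⁺ : ∀ f {z} → z < p → Unit z → InL z → T (f z) → T (any f (Lset p))
  any-Lset⁺ f {z} z<p uz Lz fz = subst T (sym (any-Lset f)) (any-applyUpTo⁺ member id p z<p
    (Equivalence.from (T-∧ {unitᵇ z ∧ inL p z})
      (Equivalence.from (T-∧ {unitᵇ z}) (Equivalence.from T-≡ (Unit⇒unitᵇ uz) , InL⇒inL Lz) , fz)))
    where
    member : ℕ → Bool
    member z = (unitᵇ z ∧ inL p z) ∧ f z

module Cyclotomic (p : ℕ) .{{_ : NonZero p}} (p-prime : Prime p) (2<p : 2 < p)
                  (g : ℕ) (g-primitive : IsPrimitiveRoot p g)
                  (ℓ : ℕ) (ℓ*|L|≡p-1 : ℓ * length (Lset p) ≡ p ∸ 1) where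

  open Subgroup p p-prime 2<p g g-primitive public

  ℓ≡index : ℓ ≡ index
  ℓ≡index = *-cancelʳ-≡ ℓ index (N / index) {{>-nonZero (m≥n⇒m/n>0 (∣⇒≤ index∣N))}} (begin
    ℓ * (N / index)          ≡⟨ cong (ℓ *_) |L|≡N/index ⟨
    ℓ * length (Lset p)      ≡⟨ ℓ*|L|≡p-1 ⟩
    N                        ≡⟨ m*[n/m]≡n index∣N ⟨
    index * (N / index)      ∎)
    where open ≡-Reasoning

  instance
    ℓ-nonZero : NonZero ℓ
    ℓ-nonZero = subst NonZero (sym ℓ≡index) index-nonZero

  ℓ∣N : ℓ ∣ N
  ℓ∣N = subst (_∣ N) (sym ℓ≡index) index∣N

  open Congruence ℓ public using ()
    renaming (_≈_ to _≈ℓ_; ≈-setoid to ≈ℓ-setoid; +-cong to +-congℓ; +-cancelˡ-≈ to +-cancelˡ-≈ℓ; 0%≡0 to 0%ℓ≡0)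

  %N-≈ℓ : ∀ x → x % N ≈ℓ x
  %N-≈ℓ x = m∣n⇒o%n%m≡o%m ℓ N x ℓ∣N

  log-*-≈ℓ : ∀ {x y} → Unit x → Unit y → log (x * y) ≈ℓ log x + log y
  log-*-≈ℓ ux uy = trans (cong (_% ℓ) (log-* ux uy)) (%N-≈ℓ _)

  log-g^-≈ℓ : ∀ k → log (g ^ k) ≈ℓ k
  log-g^-≈ℓ k = trans (cong (_% ℓ) (log-g^ k)) (%N-≈ℓ k)

  InL⇒log≈ℓ0 : ∀ {y} → Unit y → InL y → log y ≈ℓ 0
  InL⇒log≈ℓ0 {y} uy Ly = trans (n∣m⇒m%n≡0 (log y) ℓ ℓ∣log-y) (sym 0%ℓ≡0)
    where ℓ∣log-y = subst (_∣ log y) (sym ℓ≡index) (InL⇒index∣ (InL-resp-≈ (sym (g^log uy)) Ly))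

  log≈ℓ0⇒InL : ∀ {y} → Unit y → log y ≈ℓ 0 → InL y
  log≈ℓ0⇒InL {y} uy log≈0 = InL-resp-≈ (g^log uy) (index∣⇒InL index∣log-y)
    where index∣log-y = subst (_∣ log y) ℓ≡index (m%n≡0⇒n∣m (log y) ℓ (trans log≈0 0%ℓ≡0))

  -- y ∈ g^a L, with a read modulo ℓ.
  InClass : ℕ → ℕ → Set
  InClass a y = Unit y × log y ≈ℓ a

  inClass : ℕ → ℕ → Bool
  inClass a y = unitᵇ y ∧ (log y % ℓ ≡ᵇ a % ℓ)

  inClass⇒InClass : ∀ {a y} → T (inClass a y) → InClass a y
  inClass⇒InClass {a} {y} t = unitᵇ⇒Unit {y} (proj₁ u∧c) , ≡ᵇ⇒≡ (log y % ℓ) (a % ℓ) (proj₂ u∧c)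
    where u∧c = Equivalence.to (T-∧ {unitᵇ y} {log y % ℓ ≡ᵇ a % ℓ}) t

  InClass⇒inClass : ∀ {a y} → InClass a y → T (inClass a y)
  InClass⇒inClass {a} {y} (uy , log≈a) =
    Equivalence.from (T-∧ {unitᵇ y}) (Equivalence.from T-≡ (Unit⇒unitᵇ uy) , ≡⇒≡ᵇ (log y % ℓ) (a % ℓ) log≈a)

  inClass-resp-≈ : ∀ {a x y} → x ≈ y → inClass a x ≡ inClass a y
  inClass-resp-≈ {a} x≈y = cong₂ (λ u l → u ∧ (l % ℓ ≡ᵇ a % ℓ)) (unitᵇ-resp-≈ x≈y) (log-resp-≈ x≈y)

  InClass-* : ∀ {a b x y} → InClass a x → InClass b y → InClass (a + b) (x * y)
  InClass-* (ux , log-x≈a) (uy , log-y≈b) = Unit-* ux uy , trans (log-*-≈ℓ ux uy) (+-congℓ log-x≈a log-y≈b)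

  InClass-g^ : ∀ k → InClass k (g ^ k)
  InClass-g^ k = Unit-g^ k , log-g^-≈ℓ k

  InClass-N : InClass 0 N
  InClass-N = Unit-N , InL⇒log≈ℓ0 Unit-N InL-N
    where Unit-N = <p⇒Unit N<p (λ N≡0 → <⇒≢ 0<N (sym N≡0))

  InClass-*-cancelˡ : ∀ {a b x y} → InClass a x → InClass (a + b) (x * y) → InClass b y
  InClass-*-cancelˡ {a} {b} {x} {y} (ux , log-x≈a) (uxy , log-xy≈a+b) = uy , +-cancelˡ-≈ℓ a (begin
    a + log y        ≈⟨ +-congℓ log-x≈a refl ⟨
    log x + log y    ≈⟨ log-*-≈ℓ ux uy ⟨
    log (x * y)      ≈⟨ log-xy≈a+b ⟩
    a + b            ∎)
    where
    open SetoidReasoning ≈ℓ-setoid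
    uy = Unit-*⁻ʳ {x} uxy

  InClass-resp-≈ : ∀ {a x y} → x ≈ y → InClass a x → InClass a y
  InClass-resp-≈ x≈y (ux , log≈a) = Unit-resp-≈ x≈y ux , trans (cong (_% ℓ) (sym (log-resp-≈ x≈y))) log≈a

  InClass-resp-≈ℓ : ∀ {a b y} → a ≈ℓ b → InClass a y → InClass b y
  InClass-resp-≈ℓ a≈b (uy , log≈a) = uy , trans log≈a a≈b

  inAffCoset-shift : ∀ {c h x y} → x ≈ c + y → inAffCoset p c h x ≡ inAffCoset p 0 h y
  inAffCoset-shift {c} {h} {x} {y} x≈c+y = cong or (map-cong (λ z → T-injective
    (λ t → ≡⇒≡ᵇ (y % p) (h * z % p) (+-cancelˡ-≈ c (trans (sym x≈c+y) (≡ᵇ⇒≡ (x % p) ((c + h * z) % p) t))))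
    (λ t → ≡⇒≡ᵇ (x % p) ((c + h * z) % p) (trans x≈c+y (+-cong {c} refl (≡ᵇ⇒≡ (y % p) (h * z % p) t)))))
    (Lset p))

  inAffCoset-0≡inClass : ∀ {a h x} → InClass a h → inAffCoset p 0 h x ≡ inClass a x
  inAffCoset-0≡inClass {a} {h} {x} h∈C = T-injective (InClass⇒inClass ∘ ⇒InClass) (⇐InClass ∘ inClass⇒InClass)
    where
    x≈h* : ℕ → Bool
    x≈h* z = _≡ₚ_ p x (h * z)
    ⇒InClass : T (inAffCoset p 0 h x) → InClass a x
    ⇒InClass t = witness (any-Lset⁻ x≈h* t)
      where
      witness : (∃ λ z → (Unit z × InL z) × T (x≈h* z)) → InClass a x
      witness (z , (uz , Lz) , x≈hz) = InClass-resp-≈ (sym (≡ᵇ⇒≡ (x % p) (h * z % p) x≈hz))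
        (subst (λ b → InClass b (h * z)) (+-identityʳ a) (InClass-* h∈C (uz , InL⇒log≈ℓ0 uz Lz)))
    ⇐InClass : InClass a x → T (inAffCoset p 0 h x)
    ⇐InClass x∈C = any-Lset⁺ x≈h* (m%n<n (g ^ u) p) uz Lz (≡⇒≡ᵇ (x % p) (h * z % p) x≈hz)
      where
      uh = proj₁ h∈C
      u = (N ∸ log h) + log x
      z = g ^ u % p
      uz : Unit z
      uz = Unit-resp-≈ (sym (%-≈ (g ^ u))) (Unit-g^ u)
      x≈hz : x ≈ h * z
      x≈hz = begin
        x                        ≡⟨ *-identityˡ x ⟨
        1 * x                    ≈⟨ *-cong g^N≈1 (g^log (proj₁ x∈C)) ⟨
        g ^ N * g ^ log x        ≡⟨ ^-distribˡ-+-* g N (log x) ⟨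
        g ^ (N + log x)          ≡⟨ cong (λ n → g ^ (n + log x)) (m+[n∸m]≡n (<⇒≤ (log<N h))) ⟨
        g ^ (log h + (N ∸ log h) + log x)  ≡⟨ cong (g ^_) (+-assoc (log h) _ (log x)) ⟩
        g ^ (log h + u)          ≡⟨ ^-distribˡ-+-* g (log h) u ⟩
        g ^ log h * g ^ u        ≈⟨ *-cong (g^log uh) (sym (%-≈ (g ^ u))) ⟩
        h * z                    ∎
        where open ≈-Reasoning
      Lz : InL z
      Lz = log≈ℓ0⇒InL uz (proj₂ (InClass-*-cancelˡ h∈C
             (InClass-resp-≈ x≈hz (subst (λ b → InClass b x) (sym (+-identityʳ a)) x∈C))))

  InPair : ℕ → ℕ → ℕ → Set
  InPair a b y = InClass a y × InClass b (y + 1)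

  inPair : ℕ → ℕ → ℕ → Bool
  inPair a b y = inClass a y ∧ inClass b (y + 1)

  inPair-≡ : ∀ {a b c d x y} → (InPair a b x → InPair c d y) → (InPair c d y → InPair a b x) →
    inPair a b x ≡ inPair c d y
  inPair-≡ ⇒ ⇐ = T-injective (reflect⁺ ∘ ⇒ ∘ reflect⁻) (reflect⁺ ∘ ⇐ ∘ reflect⁻)
    where
    reflect⁻ : ∀ {a b y} → T (inPair a b y) → InPair a b y
    reflect⁻ {a} {b} {y} t = inClass⇒InClass (proj₁ parts) , inClass⇒InClass (proj₂ parts)
      where parts = Equivalence.to (T-∧ {inClass a y} {inClass b (y + 1)}) t
    reflect⁺ : ∀ {a b y} → InPair a b y → T (inPair a b y)
    reflect⁺ {a} {b} {y} (ya , yb) =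
      Equivalence.from (T-∧ {inClass a y} {inClass b (y + 1)}) (InClass⇒inClass ya , InClass⇒inClass yb)

  B : ℕ → ℕ → ℕ
  B a b = count (inPair a b) p

  A≡B : ∀ i j → A p g i j ≡ B i j
  A≡B i j = begin
    A p g i j            ≡⟨ length-filterᵇ-applyUpTo F id p ⟩
    count F p            ≡⟨ count-permute F p next previous (λ _ _ → m%n<n _ p) (λ _ _ → m%n<n _ p)
                                              next-previous previous-next ⟩
    count (F ∘ next) p   ≡⟨ count-cong p (λ y _ → F-next y) ⟩
    B i j                ∎
    where
    open ≡-Reasoning
    F : ℕ → Bool
    F x = inAffCoset p 1 (g ^ i) x ∧ inAffCoset p 0 (g ^ j) x
    next previous : ℕ → ℕ
    next y = (y + 1) % p
    previous x = (x + N) % p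
    next-previous : ∀ x → x < p → next (previous x) ≡ x
    next-previous x x<p = ≈⇒≡ (m%n<n _ p) x<p (trans (%-≈ _) (trans (+-cong (%-≈ (x + N)) refl) (x+N+1≈x x)))
    previous-next : ∀ y → y < p → previous (next y) ≡ y
    previous-next y y<p = ≈⇒≡ (m%n<n _ p) y<p (trans (%-≈ _) (trans (+-cong (%-≈ (y + 1)) refl) (x+1+N≈x y)))
    F-next : ∀ y → F (next y) ≡ inPair i j y
    F-next y = cong₂ _∧_
      (trans (inAffCoset-shift {1} {g ^ i} (trans (%-≈ (y + 1)) (≡⇒≈ (+-comm y 1))))
             (inAffCoset-0≡inClass {i} {g ^ i} (InClass-g^ i)))
      (trans (inAffCoset-0≡inClass {j} {g ^ j} (InClass-g^ j)) (inClass-resp-≈ {j} (%-≈ (y + 1))))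

  B-swap : ∀ a b → B a b ≡ B b a
  B-swap a b = trans (count-permute (inPair a b) p σ σ (λ _ _ → m%n<n _ p) (λ _ _ → m%n<n _ p) σ-σ σ-σ)
                     (count-cong p (λ y _ → inPair-≡ (swap-⇒ y) (swap-⇐ y)))
    where
    σ : ℕ → ℕ
    σ y = N * (y + 1) % p
    σ≈ : ∀ y → σ y ≈ N * (y + 1)
    σ≈ y = %-≈ (N * (y + 1))
    σ+1≈ : ∀ y → σ y + 1 ≈ N * y
    σ+1≈ y = begin
      σ y + 1              ≈⟨ +-cong (σ≈ y) refl ⟩
      N * (y + 1) + 1      ≡⟨ cong (_+ 1) (*-distribˡ-+ N y 1) ⟩
      N * y + N * 1 + 1    ≡⟨ cong (λ n → N * y + n + 1) (*-identityʳ N) ⟩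
      N * y + N + 1        ≈⟨ x+N+1≈x (N * y) ⟩
      N * y                ∎
      where open ≈-Reasoning
    σ-σ : ∀ y → y < p → σ (σ y) ≡ y
    σ-σ y y<p = ≈⇒≡ (m%n<n _ p) y<p (begin
      σ (σ y)              ≈⟨ σ≈ (σ y) ⟩
      N * (σ y + 1)        ≈⟨ *-congˡ {N} (σ+1≈ y) ⟩
      N * (N * y)          ≡⟨ *-assoc N N y ⟨
      N * N * y            ≈⟨ *-cong N*N≈1 refl ⟩
      1 * y                ≡⟨ *-identityˡ y ⟩
      y                    ∎)
      where open ≈-Reasoning
    N*-InClass⁻ : ∀ {c x} → InClass c (N * x) → InClass c x
    N*-InClass⁻ {c} {x} = InClass-*-cancelˡ {0} {c} {N} {x} InClass-N
    N*-InClass⁺ : ∀ {c x} → InClass c x → InClass c (N * x)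
    N*-InClass⁺ {c} {x} = InClass-* {0} {c} {N} {x} InClass-N
    swap-⇒ : ∀ y → InPair a b (σ y) → InPair b a y
    swap-⇒ y (σy∈a , σy+1∈b) =
      N*-InClass⁻ (InClass-resp-≈ {b} (σ+1≈ y) σy+1∈b) , N*-InClass⁻ (InClass-resp-≈ {a} (σ≈ y) σy∈a)
    swap-⇐ : ∀ y → InPair b a y → InPair a b (σ y)
    swap-⇐ y (y∈b , y+1∈a) =
      InClass-resp-≈ {a} (sym (σ≈ y)) (N*-InClass⁺ y+1∈a) , InClass-resp-≈ {b} (sym (σ+1≈ y)) (N*-InClass⁺ y∈b)

  InClass-1 : InClass 0 1
  InClass-1 = Unit-1 , InL⇒log≈ℓ0 Unit-1 InL-1

  N∸1≡1+[N∸2] : N ∸ 1 ≡ suc (N ∸ 2)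
  N∸1≡1+[N∸2] = lemma N (∸-monoˡ-< 2<p (s≤s z≤n))
    where
    lemma : ∀ n → 1 < n → n ∸ 1 ≡ suc (n ∸ 2)
    lemma (suc (suc n)) _ = refl
    lemma (suc zero) (s≤s ())

  -- Inversion via Fermat; it also maps 0 to 0, so it is an involution of [0, p).
  inv : ℕ → ℕ
  inv y = y ^ (N ∸ 1) % p

  inv-Unit⁺ : ∀ {y} → Unit y → Unit (inv y)
  inv-Unit⁺ {y} uy = Unit-resp-≈ (sym (%-≈ _)) (Unit-^ (N ∸ 1) uy)

  inv-Unit⁻ : ∀ {y} → Unit (inv y) → Unit y
  inv-Unit⁻ {y} u = Unit-*⁻ˡ (subst (Unit ∘ (y ^_)) N∸1≡1+[N∸2] (Unit-resp-≈ (%-≈ _) u))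

  *-inv : ∀ {y} → Unit y → y * inv y ≈ 1
  *-inv {y} uy = begin
    y * inv y              ≈⟨ *-congˡ {y} (%-≈ _) ⟩
    y * y ^ (N ∸ 1)        ≡⟨ cong (y ^_) (m+[n∸m]≡n {1} 0<N) ⟩
    y ^ N                  ≈⟨ fermat uy ⟩
    1                      ∎
    where open ≈-Reasoning

  inv-inv : ∀ y → y < p → inv (inv y) ≡ y
  inv-inv y y<p with Unit? y
  ... | yes uy  = ≈⇒≡ (m%n<n _ p) y<p (*-cancelˡ-≈ (inv-Unit⁺ uy)
                    (trans (*-inv (inv-Unit⁺ uy)) (trans (sym (*-inv uy)) (≡⇒≈ (*-comm y (inv y))))))
  ... | no ¬uy = ≈⇒≡ (m%n<n _ p) y<p (trans (¬Unit⇒≈0 (¬uy ∘ inv-Unit⁻ ∘ inv-Unit⁻)) (sym (¬Unit⇒≈0 ¬uy)))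

  inv+1 : ∀ {y} → Unit y → inv y + 1 ≈ inv y * (y + 1)
  inv+1 {y} uy = begin
    inv y + 1                ≈⟨ +-cong {inv y} refl (*-inv uy) ⟨
    inv y + y * inv y        ≡⟨ cong (inv y +_) (*-comm y (inv y)) ⟩
    inv y + inv y * y        ≡⟨ +-comm (inv y) _ ⟩
    inv y * y + inv y        ≡⟨ cong (inv y * y +_) (*-identityʳ (inv y)) ⟨
    inv y * y + inv y * 1    ≡⟨ *-distribˡ-+ (inv y) y 1 ⟨
    inv y * (y + 1)          ∎
    where open ≈-Reasoning

  InClass-inv⁺ : ∀ {a c y} → a + c ≈ℓ 0 → InClass a y → InClass c (inv y)
  InClass-inv⁺ {a} {c} {y} a+c≈0 y∈a = InClass-*-cancelˡ {a} {c} {y} {inv y} y∈a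
    (InClass-resp-≈ℓ {0} {a + c} (sym a+c≈0) (InClass-resp-≈ {0} (sym (*-inv (proj₁ y∈a))) InClass-1))

  InClass-inv⁻ : ∀ {a c y} → a + c ≈ℓ 0 → InClass c (inv y) → InClass a y
  InClass-inv⁻ {a} {c} {y} a+c≈0 inv∈c = InClass-*-cancelˡ {c} {a} {inv y} {y} inv∈c
    (InClass-resp-≈ℓ {0} {c + a} (trans (sym a+c≈0) (cong (_% ℓ) (+-comm a c)))
      (InClass-resp-≈ {0} (trans (sym (*-inv uy)) (≡⇒≈ (*-comm y (inv y)))) InClass-1))
    where uy = inv-Unit⁻ {y} (proj₁ inv∈c)

  B-inv : ∀ a b c → a + c ≈ℓ 0 → B a b ≡ B c (c + b)
  B-inv a b c a+c≈0 = sym (trans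
    (count-permute (inPair c (c + b)) p inv inv (λ _ _ → m%n<n _ p) (λ _ _ → m%n<n _ p) inv-inv inv-inv)
    (count-cong p (λ y _ → inPair-≡ (inv-⇒ y) (inv-⇐ y))))
    where
    inv-⇒ : ∀ y → InPair c (c + b) (inv y) → InPair a b y
    inv-⇒ y (inv∈c , inv+1∈c+b) = y∈a , InClass-*-cancelˡ {c} {b} {inv y} {y + 1} inv∈c
                                           (InClass-resp-≈ {c + b} (inv+1 (proj₁ y∈a)) inv+1∈c+b)
      where y∈a = InClass-inv⁻ {a} {c} {y} a+c≈0 inv∈c
    inv-⇐ : ∀ y → InPair a b y → InPair c (c + b) (inv y)
    inv-⇐ y (y∈a , y+1∈b) = inv∈c , InClass-resp-≈ {c + b} (sym (inv+1 (proj₁ y∈a)))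
                                         (InClass-* {c} {b} {inv y} {y + 1} inv∈c y+1∈b)
      where inv∈c = InClass-inv⁺ {a} {c} {y} a+c≈0 y∈a

  class-size : ∀ a → count (inClass a) p ≡ N / ℓ
  class-size a = begin
    count (inClass a) p                          ≡⟨ count-via-log (inClass a) inClass-a-0 ⟩
    count (λ k → inClass a (g ^ k % p)) N        ≡⟨ count-cong N (λ k _ → inClass-g^ k) ⟩
    count (λ k → k % ℓ ≡ᵇ a % ℓ) N               ≡⟨ cong (count _) (m*[n/m]≡n ℓ∣N) ⟨
    count (λ k → k % ℓ ≡ᵇ a % ℓ) (ℓ * (N / ℓ))   ≡⟨ count-%≡ᵇ ℓ (m%n<n a ℓ) (N / ℓ) ⟩
    N / ℓ                                        ∎
    where
    open ≡-Reasoning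
    inClass-a-0 : inClass a 0 ≡ false
    inClass-a-0 = cong (_∧ (log 0 % ℓ ≡ᵇ a % ℓ)) (¬Unit⇒unitᵇ {0} ¬Unit-0)
    inClass-g^ : ∀ k → inClass a (g ^ k % p) ≡ (k % ℓ ≡ᵇ a % ℓ)
    inClass-g^ k = begin
      inClass a (g ^ k % p)                        ≡⟨ inClass-resp-≈ {a} (%-≈ (g ^ k)) ⟩
      unitᵇ (g ^ k) ∧ (log (g ^ k) % ℓ ≡ᵇ a % ℓ)   ≡⟨ cong₂ (λ u l → u ∧ (l ≡ᵇ a % ℓ)) (Unit⇒unitᵇ (Unit-g^ k)) (log-g^-≈ℓ k) ⟩
      k % ℓ ≡ᵇ a % ℓ                               ∎

  sumBelow-B : ∀ a m → m ≤ ℓ →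
    sumBelow (B a) m ≡ count (λ y → (inClass a y ∧ unitᵇ (y + 1)) ∧ (log (y + 1) % ℓ <ᵇ m)) p
  sumBelow-B a zero    _   = sym (count-false p (λ y _ → ∧-zeroʳ (inClass a y ∧ unitᵇ (y + 1))))
  sumBelow-B a (suc m) m<ℓ = begin
    sumBelow (B a) m + B a m                                 ≡⟨ cong (_+ B a m) (sumBelow-B a m (<⇒≤ m<ℓ)) ⟩
    count (λ y → U y ∧ (c y <ᵇ m)) p + count (inPair a m) p  ≡⟨ count-split p (λ y _ → split y) ⟨
    count (λ y → U y ∧ (c y <ᵇ suc m)) p                     ∎
    where
    open ≡-Reasoning
    U : ℕ → Bool
    U y = inClass a y ∧ unitᵇ (y + 1)
    c : ℕ → ℕ
    c y = log (y + 1) % ℓ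
    split : ∀ y → indicator (U y ∧ (c y <ᵇ suc m)) ≡ indicator (U y ∧ (c y <ᵇ m)) + indicator (inPair a m y)
    split y = begin
      indicator (U y ∧ (c y <ᵇ suc m))
        ≡⟨ indicator-<ᵇ-suc (U y) (c y) m ⟩
      below + indicator (U y ∧ (c y ≡ᵇ m))
        ≡⟨ cong (λ r → below + indicator (U y ∧ (c y ≡ᵇ r))) (m<n⇒m%n≡m m<ℓ) ⟨
      below + indicator (U y ∧ (c y ≡ᵇ m % ℓ))
        ≡⟨ cong (λ r → below + indicator r) (∧-assoc (inClass a y) (unitᵇ (y + 1)) (c y ≡ᵇ m % ℓ)) ⟩
      below + indicator (inPair a m y)
        ∎
      where below = indicator (U y ∧ (c y <ᵇ m))

  -- The only y for which y + 1 is not a unit is y = N = -1, and N lies in class 0.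
  row-sum : ∀ a → sumBelow (B a) ℓ + indicator (inClass a N) ≡ N / ℓ
  row-sum a = begin
    sumBelow (B a) ℓ + indicator (inClass a N)
      ≡⟨ cong₂ _+_ successor-unit successor-not-unit ⟨
    count (λ y → inClass a y ∧ unitᵇ (y + 1)) p + count (λ y → inClass a y ∧ not (unitᵇ (y + 1))) p
      ≡⟨ count-split p (λ y _ → indicator-split (inClass a y) (unitᵇ (y + 1))) ⟨
    count (inClass a) p
      ≡⟨ class-size a ⟩
    N / ℓ ∎
    where
    open ≡-Reasoning
    successor-unit : count (λ y → inClass a y ∧ unitᵇ (y + 1)) p ≡ sumBelow (B a) ℓ
    successor-unit = trans (count-cong p (λ y _ → class<ℓ y)) (sym (sumBelow-B a ℓ ≤-refl))
      where
      class<ℓ : ∀ y → inClass a y ∧ unitᵇ (y + 1) ≡ (inClass a y ∧ unitᵇ (y + 1)) ∧ (log (y + 1) % ℓ <ᵇ ℓ)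
      class<ℓ y = sym (trans (cong (U ∧_) (dec-true (log (y + 1) % ℓ <? ℓ) (m%n<n (log (y + 1)) ℓ))) (∧-identityʳ U))
        where U = inClass a y ∧ unitᵇ (y + 1)
    non-unit-successor : ∀ y → y < p → Tri (y < N) (y ≡ N) (N < y) →
      inClass a y ∧ not (unitᵇ (y + 1)) ≡ (y ≡ᵇ N) ∧ inClass a N
    non-unit-successor y y<p (tri≈ _ refl _) = begin
      inClass a N ∧ not (unitᵇ (N + 1))     ≡⟨ cong (λ u → inClass a N ∧ not u) (¬Unit⇒unitᵇ {N + 1} ¬Unit-N+1) ⟩
      inClass a N ∧ true                    ≡⟨ ∧-identityʳ (inClass a N) ⟩
      inClass a N                           ≡⟨ cong (_∧ inClass a N) (dec-true (N ≟ N) refl) ⟨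
      (N ≡ᵇ N) ∧ inClass a N                ∎
      where
      ¬Unit-N+1 : ¬ Unit (N + 1)
      ¬Unit-N+1 = ¬Unit-0 ∘ Unit-resp-≈ (trans (≡⇒≈ (trans (+-comm N 1) (sym p≡1+N))) m≈0)
    non-unit-successor y y<p (tri< y<N y≢N _) = begin
      inClass a y ∧ not (unitᵇ (y + 1))     ≡⟨ cong (λ u → inClass a y ∧ not u) (Unit⇒unitᵇ {y + 1} (<p⇒Unit y+1<p y+1≢0)) ⟩
      inClass a y ∧ false                   ≡⟨ ∧-zeroʳ (inClass a y) ⟩
      false                                 ≡⟨ cong (_∧ inClass a N) (dec-false (y ≟ N) y≢N) ⟨
      (y ≡ᵇ N) ∧ inClass a N                ∎
      where
      y+1<p : y + 1 < p
      y+1<p = subst (_< p) (+-comm 1 y) (subst (suc y <_) (sym p≡1+N) (s≤s y<N))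
      y+1≢0 : y + 1 ≢ 0
      y+1≢0 y+1≡0 = 1+n≢0 (trans (+-comm 1 y) y+1≡0)
    non-unit-successor y y<p (tri> _ _ N<y) = ⊥-elim (<⇒≱ y<p (subst (_≤ y) (sym p≡1+N) N<y))
    count-≡ᵇN : ∀ b → count (λ y → (y ≡ᵇ N) ∧ b) p ≡ indicator b
    count-≡ᵇN true  = trans (count-cong p (λ y _ → ∧-identityʳ (y ≡ᵇ N))) (count-≡ᵇ p N<p)
    count-≡ᵇN false = count-false p (λ y _ → ∧-zeroʳ (y ≡ᵇ N))
    successor-not-unit : count (λ y → inClass a y ∧ not (unitᵇ (y + 1))) p ≡ indicator (inClass a N)
    successor-not-unit =
      trans (count-cong p (λ y y<p → non-unit-successor y y<p (<-cmp y N))) (count-≡ᵇN (inClass a N))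

  row-sum-0 : sumBelow (B 0) ℓ + 1 ≡ N / ℓ
  row-sum-0 = subst (λ b → sumBelow (B 0) ℓ + indicator b ≡ N / ℓ) inClass-0-N (row-sum 0)
    where
    inClass-0-N : inClass 0 N ≡ true
    inClass-0-N = Equivalence.to T-≡ (InClass⇒inClass {0} {N} InClass-N)

  row-sum-≉0 : ∀ a → ¬ a ≈ℓ 0 → sumBelow (B a) ℓ ≡ N / ℓ
  row-sum-≉0 a a≉0 = begin
    sumBelow (B a) ℓ                              ≡⟨ +-identityʳ (sumBelow (B a) ℓ) ⟨
    sumBelow (B a) ℓ + indicator false            ≡⟨ cong (λ b → sumBelow (B a) ℓ + indicator b) inClass-a-N ⟨
    sumBelow (B a) ℓ + indicator (inClass a N)    ≡⟨ row-sum a ⟩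
    N / ℓ                                         ∎
    where
    open ≡-Reasoning
    inClass-a-N : inClass a N ≡ false
    inClass-a-N = T-injective {inClass a N} {false}
      (λ t → a≉0 (trans (sym (proj₂ (inClass⇒InClass {a} {N} t))) (proj₂ InClass-N))) (λ ())

rows₃ : ∀ x₀ x₁ x₂ y f → x₀ + x₁ + x₂ + 1 ≡ f → x₁ + x₂ + y ≡ f → y ≡ suc x₀
rows₃ x₀ x₁ x₂ y f row₀ row₁ = +-cancelˡ-≡ (x₁ + x₂) y (suc x₀) (begin
  x₁ + x₂ + y             ≡⟨ row₁ ⟩
  f                       ≡⟨ row₀ ⟨
  x₀ + x₁ + x₂ + 1        ≡⟨ rearrange x₀ x₁ x₂ ⟩
  x₁ + x₂ + suc x₀        ∎)
  where
  open ≡-Reasoning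
  rearrange : ∀ x₀ x₁ x₂ → x₀ + x₁ + x₂ + 1 ≡ x₁ + x₂ + suc x₀
  rearrange = solve-∀

rows₄ : ∀ x₀ x₁ x₂ x₃ y f → x₀ + x₁ + x₂ + x₃ + 1 ≡ f → x₁ + x₃ + y + y ≡ f → y + y ≡ suc (x₀ + x₂)
rows₄ x₀ x₁ x₂ x₃ y f row₀ row₁ = +-cancelˡ-≡ (x₁ + x₃) (y + y) (suc (x₀ + x₂)) (begin
  x₁ + x₃ + (y + y)        ≡⟨ +-assoc (x₁ + x₃) y y ⟨
  x₁ + x₃ + y + y          ≡⟨ row₁ ⟩
  f                        ≡⟨ row₀ ⟨
  x₀ + x₁ + x₂ + x₃ + 1    ≡⟨ rearrange x₀ x₁ x₂ x₃ ⟩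
  x₁ + x₃ + suc (x₀ + x₂)  ∎)
  where
  open ≡-Reasoning
  rearrange : ∀ x₀ x₁ x₂ x₃ → x₀ + x₁ + x₂ + x₃ + 1 ≡ x₁ + x₃ + suc (x₀ + x₂)
  rearrange = solve-∀

rows₅ : ∀ x₀ x₁ x₂ x₃ x₄ y z f → x₀ + x₁ + x₂ + x₃ + x₄ + 1 ≡ f →
  x₁ + x₄ + y + z + y ≡ f → x₂ + y + x₃ + z + z ≡ f → 3 * (y + z) ≡ f + suc x₀
rows₅ x₀ x₁ x₂ x₃ x₄ y z f row₀ row₁ row₂ = +-cancelˡ-≡ (x₁ + x₂ + x₃ + x₄) (3 * (y + z)) (f + suc x₀) (begin
  x₁ + x₂ + x₃ + x₄ + 3 * (y + z)                          ≡⟨ rearrange₁ x₁ x₂ x₃ x₄ y z ⟩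
  (x₁ + x₄ + y + z + y) + (x₂ + y + x₃ + z + z)            ≡⟨ cong₂ _+_ row₁ row₂ ⟩
  f + f                                                    ≡⟨ cong (_+ f) row₀ ⟨
  x₀ + x₁ + x₂ + x₃ + x₄ + 1 + f                           ≡⟨ rearrange₂ x₀ x₁ x₂ x₃ x₄ f ⟩
  x₁ + x₂ + x₃ + x₄ + (f + suc x₀)                         ∎)
  where
  open ≡-Reasoning
  rearrange₁ : ∀ x₁ x₂ x₃ x₄ y z → x₁ + x₂ + x₃ + x₄ + 3 * (y + z) ≡ (x₁ + x₄ + y + z + y) + (x₂ + y + x₃ + z + z)
  rearrange₁ = solve-∀
  rearrange₂ : ∀ x₀ x₁ x₂ x₃ x₄ f → x₀ + x₁ + x₂ + x₃ + x₄ + 1 + f ≡ x₁ + x₂ + x₃ + x₄ + (f + suc x₀)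
  rearrange₂ = solve-∀

module _ (p : ℕ) .{{_ : NonZero p}} (p-prime : Prime p) (2<p : 2 < p) (g : ℕ) (g-primitive : IsPrimitiveRoot p g) where

  s-positive-3 : 3 * length (Lset p) ≡ p ∸ 1 → 0 < s p g 3
  s-positive-3 3*|L|≡p-1 = subst (0 <_) (sym s≡2*B₁₂) (subst (λ b → 0 < b + (b + 0)) (sym B₁₂≡1+B₀₀) z<s)
    where
    open Cyclotomic p p-prime 2<p g g-primitive 3 3*|L|≡p-1
    B₁₁≡B₀₂ : B 1 1 ≡ B 0 2
    B₁₁≡B₀₂ = trans (B-inv 1 1 2 refl) (B-swap 2 0)
    row₁ : B 0 1 + B 0 2 + B 1 2 ≡ N / 3
    row₁ = trans (cong₂ (λ u v → u + v + B 1 2) (B-swap 0 1) (sym B₁₁≡B₀₂)) (row-sum-≉0 1 (λ ()))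
    B₁₂≡1+B₀₀ : B 1 2 ≡ suc (B 0 0)
    B₁₂≡1+B₀₀ = rows₃ (B 0 0) (B 0 1) (B 0 2) (B 1 2) (N / 3) row-sum-0 row₁
    s≡2*B₁₂ : s p g 3 ≡ B 1 2 + (B 1 2 + 0)
    s≡2*B₁₂ = cong₂ (λ u v → u + (v + 0)) (A≡B 1 2) (trans (A≡B 2 4) (B-swap 2 1))

  s-positive-4 : 4 * length (Lset p) ≡ p ∸ 1 → 0 < s p g 4
  s-positive-4 4*|L|≡p-1 = subst (0 <_) (sym s≡) (≤-trans 0<B₁₂ (m≤m+n (B 1 2) (B 3 2 + 0)))
    where
    open Cyclotomic p p-prime 2<p g g-primitive 4 4*|L|≡p-1
    B₁₃≡B₁₂ : B 1 3 ≡ B 1 2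
    B₁₃≡B₁₂ = sym (trans (B-inv 1 2 3 refl) (B-swap 3 1))
    B₁₁≡B₀₃ : B 1 1 ≡ B 0 3
    B₁₁≡B₀₃ = trans (B-inv 1 1 3 refl) (B-swap 3 0)
    row₁ : B 0 1 + B 0 3 + B 1 2 + B 1 2 ≡ N / 4
    row₁ = begin
      B 0 1 + B 0 3 + B 1 2 + B 1 2   ≡⟨ cong₂ (λ u v → u + v + B 1 2 + B 1 2) (B-swap 0 1) (sym B₁₁≡B₀₃) ⟩
      B 1 0 + B 1 1 + B 1 2 + B 1 2   ≡⟨ cong (B 1 0 + B 1 1 + B 1 2 +_) (sym B₁₃≡B₁₂) ⟩
      B 1 0 + B 1 1 + B 1 2 + B 1 3   ≡⟨ row-sum-≉0 1 (λ ()) ⟩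
      N / 4                           ∎
      where open ≡-Reasoning
    2*B₁₂≡1+B₀₀+B₀₂ : B 1 2 + B 1 2 ≡ suc (B 0 0 + B 0 2)
    2*B₁₂≡1+B₀₀+B₀₂ = rows₄ (B 0 0) (B 0 1) (B 0 2) (B 0 3) (B 1 2) (N / 4) row-sum-0 row₁
    0<B₁₂ : 0 < B 1 2
    0<B₁₂ = n≢0⇒n>0 (λ B₁₂≡0 → 0≢1+n (trans (cong (λ b → b + b) (sym B₁₂≡0)) 2*B₁₂≡1+B₀₀+B₀₂))
    s≡ : s p g 4 ≡ B 1 2 + (B 3 2 + 0)
    s≡ = cong₂ (λ u v → u + (v + 0)) (A≡B 1 2) (A≡B 3 6)

  s-positive-5 : 5 * length (Lset p) ≡ p ∸ 1 → 0 < s p g 5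
  s-positive-5 5*|L|≡p-1 = subst (0 <_) (sym s≡) (≤-trans 0<B₁₂+B₁₃ (+-monoʳ-≤ (B 1 2) (m≤m+n (B 1 3) _)))
    where
    open Cyclotomic p p-prime 2<p g g-primitive 5 5*|L|≡p-1
    B₁₁≡B₀₄ : B 1 1 ≡ B 0 4
    B₁₁≡B₀₄ = trans (B-inv 1 1 4 refl) (B-swap 4 0)
    B₁₄≡B₁₂ : B 1 4 ≡ B 1 2
    B₁₄≡B₁₂ = sym (trans (B-inv 1 2 4 refl) (B-swap 4 1))
    B₂₂≡B₀₃ : B 2 2 ≡ B 0 3
    B₂₂≡B₀₃ = trans (B-inv 2 2 3 refl) (B-swap 3 0)
    B₂₃≡B₁₃ : B 2 3 ≡ B 1 3
    B₂₃≡B₁₃ = trans (B-inv 2 3 3 refl) (B-swap 3 1)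
    B₂₄≡B₁₃ : B 2 4 ≡ B 1 3
    B₂₄≡B₁₃ = trans (B-inv 2 4 3 refl) (trans (B-swap 3 2) B₂₃≡B₁₃)
    row₁ : B 0 1 + B 0 4 + B 1 2 + B 1 3 + B 1 2 ≡ N / 5
    row₁ = begin
      B 0 1 + B 0 4 + B 1 2 + B 1 3 + B 1 2   ≡⟨ cong₂ (λ u v → u + v + B 1 2 + B 1 3 + B 1 2) (B-swap 0 1) (sym B₁₁≡B₀₄) ⟩
      B 1 0 + B 1 1 + B 1 2 + B 1 3 + B 1 2   ≡⟨ cong (B 1 0 + B 1 1 + B 1 2 + B 1 3 +_) (sym B₁₄≡B₁₂) ⟩
      B 1 0 + B 1 1 + B 1 2 + B 1 3 + B 1 4   ≡⟨ row-sum-≉0 1 (λ ()) ⟩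
      N / 5                                   ∎
      where open ≡-Reasoning
    row₂ : B 0 2 + B 1 2 + B 0 3 + B 1 3 + B 1 3 ≡ N / 5
    row₂ = begin
      B 0 2 + B 1 2 + B 0 3 + B 1 3 + B 1 3   ≡⟨ cong₂ (λ u v → u + v + B 0 3 + B 1 3 + B 1 3) (B-swap 0 2) (B-swap 1 2) ⟩
      B 2 0 + B 2 1 + B 0 3 + B 1 3 + B 1 3   ≡⟨ cong₂ (λ u v → B 2 0 + B 2 1 + u + v + B 1 3) (sym B₂₂≡B₀₃) (sym B₂₃≡B₁₃) ⟩
      B 2 0 + B 2 1 + B 2 2 + B 2 3 + B 1 3   ≡⟨ cong (B 2 0 + B 2 1 + B 2 2 + B 2 3 +_) (sym B₂₄≡B₁₃) ⟩
      B 2 0 + B 2 1 + B 2 2 + B 2 3 + B 2 4   ≡⟨ row-sum-≉0 2 (λ ()) ⟩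
      N / 5                                   ∎
      where open ≡-Reasoning
    3*[B₁₂+B₁₃]≡N/5+1+B₀₀ : 3 * (B 1 2 + B 1 3) ≡ N / 5 + suc (B 0 0)
    3*[B₁₂+B₁₃]≡N/5+1+B₀₀ = rows₅ (B 0 0) (B 0 1) (B 0 2) (B 0 3) (B 0 4) (B 1 2) (B 1 3) (N / 5) row-sum-0 row₁ row₂
    0<B₁₂+B₁₃ : 0 < B 1 2 + B 1 3
    0<B₁₂+B₁₃ = n≢0⇒n>0 (λ B₁₂+B₁₃≡0 → 0≢1+n (trans (cong (3 *_) (sym B₁₂+B₁₃≡0))
                                       (trans 3*[B₁₂+B₁₃]≡N/5+1+B₀₀ (+-suc (N / 5) (B 0 0)))))
    s≡ : s p g 5 ≡ B 1 2 + (B 1 3 + (B 3 1 + (B 4 3 + 0)))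
    s≡ = trans (cong₂ (λ u v → u + (v + (A p g 3 6 + (A p g 4 8 + 0)))) (A≡B 1 2) (trans (A≡B 2 4) B₂₄≡B₁₃))
               (cong₂ (λ u v → B 1 2 + (B 1 3 + (u + (v + 0)))) (A≡B 3 6) (A≡B 4 8))

odd-prime⇒2<p : ∀ {p} → Prime p → p % 2 ≡ 1 → 2 < p
odd-prime⇒2<p {p} p-prime p-odd with m≤n⇒m<n∨m≡n (nonTrivial⇒n>1 p {{prime⇒nonTrivial p-prime}})
... | inj₁ 2<p   = 2<p
... | inj₂ refl with () ← p-odd

proposition3p2 : (p : ℕ) .{{_ : NonZero p}} → Prime p → p % 2 ≡ 1 →
    (g : ℕ) → IsPrimitiveRoot p g →
    (ℓ : ℕ) → ℓ * length (Lset p) ≡ p ∸ 1 →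
    (ℓ ≡ 3 ⊎ ℓ ≡ 4 ⊎ ℓ ≡ 5) →
    0 < s p g ℓ
proposition3p2 p p-prime p-odd g g-primitive .3 ℓ*|L|≡p-1 (inj₁ refl) =
  s-positive-3 p p-prime (odd-prime⇒2<p p-prime p-odd) g g-primitive ℓ*|L|≡p-1
proposition3p2 p p-prime p-odd g g-primitive .4 ℓ*|L|≡p-1 (inj₂ (inj₁ refl)) =
  s-positive-4 p p-prime (odd-prime⇒2<p p-prime p-odd) g g-primitive ℓ*|L|≡p-1
proposition3p2 p p-prime p-odd g g-primitive .5 ℓ*|L|≡p-1 (inj₂ (inj₂ refl)) =
  s-positive-5 p p-prime (odd-prime⇒2<p p-prime p-odd) g g-primitive ℓ*|L|≡p-1
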